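{- Let $\Gamma$ be a cubic tricirculant, let $\rho$ be an automorphism of $\Gamma$ generating a cyclic group with exactly three orbits on vertices, all of equal size larger than $1$, and let $n$ be the order of $\rho$. Then $n=2k$ for some positive integer $k$, and there exist $r,s\in\mathbb{Z}_{n}$ such that $\Gamma$ is isomorphic to one of $T_1(k,r,s)$, $T_2(k,r,s)$, $T_3(k,r)$, $T_4(k,r,s)$.
   Context: All graphs are finite and simple; cubic means connected and $3$-regular; a tricirculant is a connected graph admitting a cyclic group of automorphisms with exactly three vertex-orbits, all of equal size larger than $1$. For a positive integer $k$ and $r,s\in\mathbb{Z}_{2k}$, each of the following graphs has vertex set $\{u_i,v_i,w_i: i\in\mathbb{Z}_{2k}\}$: $T_1(k,r,s)$ has edges $u_iu_{i+k}$, $u_iv_i$, $u_iw_i$, $v_iw_{i+r}$, $v_iw_{i+s}$ ($i\in\mathbb{Z}_{2k}$); $T_2(k,r,s)$ has edges $w_iw_{i+k}$, $u_iv_i$, $u_iw_i$, $u_iw_{i+r}$, $v_iv_{i+s}$; $T_3(k,r)$ has edges $u_iu_{i+k}$, $v_iv_{i+k}$, $w_iw_{i+k}$, $u_iv_i$, $u_iw_i$, $v_iw_{i+r}$; $T_4(k,r,s)$ has edges $u_iu_{i+k}$, $u_iv_i$, $u_iw_i$, $w_iw_{i+r}$, $v_iv_{i+s}$. -}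

module Defs where

open import Data.Nat using (ℕ; zero; suc; _+_; _*_; _≤_; _<_)
open import Data.Nat.DivMod using (_mod_)
open import Data.Fin using (Fin; toℕ)
open import Data.Fin.Permutation using (Permutation′; _⟨$⟩ʳ_)
open import Data.Product using (Σ; ∃; _×_; _,_)
open import Data.Sum using (_⊎_)
open import Relation.Nullary using (¬_; Dec)
open import Relation.Binary.PropositionalEquality using (_≡_)
open import Relation.Binary.Construct.Closure.ReflexiveTransitive using (Star)
open import Function.Bundles using (_⤖_; Bijection)

record Graph : Set₁ where
  field
    N     : ℕ
    Adj   : Fin N → Fin N → Set
    adj?  : ∀ x y → Dec (Adj x y)
    sym   : ∀ {x y} → Adj x y → Adj y x
    irrefl : ∀ {x} → ¬ Adj x x

open Graph public

ThreeRegular : Graph → Set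
ThreeRegular Γ = ∀ x → Σ (Fin (N Γ)) λ a → Σ (Fin (N Γ)) λ b → Σ (Fin (N Γ)) λ c →
  Adj Γ x a × Adj Γ x b × Adj Γ x c ×
  ¬ a ≡ b × ¬ a ≡ c × ¬ b ≡ c ×
  (∀ y → Adj Γ x y → y ≡ a ⊎ y ≡ b ⊎ y ≡ c)

Connected : Graph → Set
Connected Γ = ∀ x y → Star (Adj Γ) x y

Cubic : Graph → Set
Cubic Γ = Connected Γ × ThreeRegular Γ

IsAutomorphism : (Γ : Graph) → Permutation′ (N Γ) → Set
IsAutomorphism Γ ρ = ∀ x y → (Adj Γ x y → Adj Γ (ρ ⟨$⟩ʳ x) (ρ ⟨$⟩ʳ y))
                           × (Adj Γ (ρ ⟨$⟩ʳ x) (ρ ⟨$⟩ʳ y) → Adj Γ x y)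

pow : ∀ {M} → Permutation′ M → ℕ → Fin M → Fin M
pow ρ zero    x = x
pow ρ (suc i) x = ρ ⟨$⟩ʳ (pow ρ i x)

IsOrder : ∀ {M} → Permutation′ M → ℕ → Set
IsOrder {M} ρ n = 0 < n × (∀ x → pow ρ n x ≡ x)
                × (∀ m → 0 < m → (∀ x → pow ρ m x ≡ x) → n ≤ m)

SameOrbit : ∀ {M} → Permutation′ M → Fin M → Fin M → Set
SameOrbit ρ x y = ∃ λ i → pow ρ i x ≡ y

OrbitSize : ∀ {M} → Permutation′ M → Fin M → ℕ → Set
OrbitSize ρ x m = 0 < m × pow ρ m x ≡ x × (∀ d → 0 < d → pow ρ d x ≡ x → m ≤ d)

ThreeEqualOrbits : ∀ {M} → Permutation′ M → Set
ThreeEqualOrbits {M} ρ = Σ (Fin M) λ a → Σ (Fin M) λ b → Σ (Fin M) λ c →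
  ¬ SameOrbit ρ a b × ¬ SameOrbit ρ a c × ¬ SameOrbit ρ b c ×
  (∀ x → SameOrbit ρ a x ⊎ SameOrbit ρ b x ⊎ SameOrbit ρ c x) ×
  (Σ ℕ λ m → 1 < m × OrbitSize ρ a m × OrbitSize ρ b m × OrbitSize ρ c m)

data TV (k : ℕ) : Set where
  u v w : Fin (2 * k) → TV k

_⊕_ : ∀ {n} → Fin n → ℕ → Fin n
_⊕_ {suc n} i j = (toℕ i + j) mod (suc n)

SymClo : ∀ {A : Set} → (A → A → Set) → A → A → Set
SymClo E x y = E x y ⊎ E y x

data T₁E (k : ℕ) (r s : Fin (2 * k)) : TV k → TV k → Set where
  e1 : ∀ i → T₁E k r s (u i) (u (i ⊕ k))
  e2 : ∀ i → T₁E k r s (u i) (v i)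
  e3 : ∀ i → T₁E k r s (u i) (w i)
  e4 : ∀ i → T₁E k r s (v i) (w (i ⊕ toℕ r))
  e5 : ∀ i → T₁E k r s (v i) (w (i ⊕ toℕ s))

data T₂E (k : ℕ) (r s : Fin (2 * k)) : TV k → TV k → Set where
  e1 : ∀ i → T₂E k r s (w i) (w (i ⊕ k))
  e2 : ∀ i → T₂E k r s (u i) (v i)
  e3 : ∀ i → T₂E k r s (u i) (w i)
  e4 : ∀ i → T₂E k r s (u i) (w (i ⊕ toℕ r))
  e5 : ∀ i → T₂E k r s (v i) (v (i ⊕ toℕ s))

data T₃E (k : ℕ) (r : Fin (2 * k)) : TV k → TV k → Set where
  e1 : ∀ i → T₃E k r (u i) (u (i ⊕ k))
  e2 : ∀ i → T₃E k r (v i) (v (i ⊕ k))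
  e3 : ∀ i → T₃E k r (w i) (w (i ⊕ k))
  e4 : ∀ i → T₃E k r (u i) (v i)
  e5 : ∀ i → T₃E k r (u i) (w i)
  e6 : ∀ i → T₃E k r (v i) (w (i ⊕ toℕ r))

data T₄E (k : ℕ) (r s : Fin (2 * k)) : TV k → TV k → Set where
  e1 : ∀ i → T₄E k r s (u i) (u (i ⊕ k))
  e2 : ∀ i → T₄E k r s (u i) (v i)
  e3 : ∀ i → T₄E k r s (u i) (w i)
  e4 : ∀ i → T₄E k r s (w i) (w (i ⊕ toℕ r))
  e5 : ∀ i → T₄E k r s (v i) (v (i ⊕ toℕ s))

T₁ T₂ T₄ : (k : ℕ) → Fin (2 * k) → Fin (2 * k) → TV k → TV k → Set
T₁ k r s = SymClo (T₁E k r s)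
T₂ k r s = SymClo (T₂E k r s)
T₄ k r s = SymClo (T₄E k r s)

T₃ : (k : ℕ) → Fin (2 * k) → TV k → TV k → Set
T₃ k r = SymClo (T₃E k r)

IsoTo : (Γ : Graph) (k : ℕ) → (TV k → TV k → Set) → Set
IsoTo Γ k T = Σ (Fin (N Γ) ⤖ TV k) λ f →
  ∀ x y → (Adj Γ x y → T (Bijection.to f x) (Bijection.to f y))
        × (T (Bijection.to f x) (Bijection.to f y) → Adj Γ x y)

-- Since ρ^m fixes a point of every orbit (m the common orbit size), ρ^m = id, so each
-- orbit has the full length n.  Let links x y be the number of neighbours of x in the
-- orbit of y.  Between three orbit representatives a, b, c this gives a symmetric
-- 3 × 3 matrix whose rows sum to the valency 3, and connectivity forbids an orbit
-- that is linked to neither of the others.  These valency equations have few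
-- solutions: a pair of orbits is unlinked, or doubly linked, or all pairs are linked
-- once; a single neighbour inside its own orbit must be antipodal, which gives n = 2k.
-- Each solution yields representatives U, V, W realising the edges of one T_j at
-- index 0.  Finally X_i ↦ ρ^i X is an isomorphism T_j ≅ Γ: T_j is generated by a short
-- list of edge types, and at each representative three distinct listed edges already
-- account for all three neighbours.
module Submission where

open import Defs hiding (sym)
open import Data.Nat
open import Data.Nat.Properties
open import Data.Nat.DivMod
open import Data.Nat.Tactic.RingSolver
open import Data.Fin as F using (Fin; toℕ; fromℕ<)
import Data.Fin.Properties as FP
open import Data.Fin.Permutation using (Permutation′; _⟨$⟩ʳ_; _⟨$⟩ˡ_; inverseˡ)
open import Data.Product using (Σ; ∃; _×_; _,_; proj₁; proj₂)
open import Data.Sum using (_⊎_; inj₁; inj₂)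
open import Data.Empty using (⊥; ⊥-elim)
open import Data.List using (List; []; _∷_)
open import Data.List.Membership.Propositional using (_∈_)
open import Data.List.Relation.Unary.Any using (here; there)
open import Function using (_∘_)
open import Function.Bundles using (mk⤖; Bijection)
open import Relation.Nullary using (¬_; Dec; yes; no)
open import Relation.Binary.PropositionalEquality
open import Relation.Binary.Definitions using (tri<; tri≈; tri>)
open import Relation.Binary.Construct.Closure.ReflexiveTransitive using (Star; ε; _◅_)

∑ : ℕ → (ℕ → ℕ) → ℕ
∑ zero    f = 0
∑ (suc m) f = ∑ m f + f m

∑-ext : ∀ m {f g : ℕ → ℕ} → (∀ t → t < m → f t ≡ g t) → ∑ m f ≡ ∑ m g
∑-ext zero    f≗g = refl
∑-ext (suc m) f≗g = cong₂ _+_ (∑-ext m (λ t t<m → f≗g t (m<n⇒m<1+n t<m))) (f≗g m ≤-refl)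

∑-+ : ∀ m (f g : ℕ → ℕ) → ∑ m (λ t → f t + g t) ≡ ∑ m f + ∑ m g
∑-+ zero    f g = refl
∑-+ (suc m) f g = trans (cong (_+ (f m + g m)) (∑-+ m f g)) (interchange (∑ m f) (∑ m g) (f m) (g m))
  where
    interchange : ∀ a b c d → (a + b) + (c + d) ≡ (a + c) + (b + d)
    interchange = solve-∀

∑-suc : ∀ m (f : ℕ → ℕ) → ∑ (suc m) f ≡ f 0 + ∑ m (λ t → f (suc t))
∑-suc zero    f = +-comm 0 (f 0)
∑-suc (suc m) f = trans (cong (_+ f (suc m)) (∑-suc m f)) (+-assoc (f 0) _ _)

∑-reverse : ∀ m (f : ℕ → ℕ) → ∑ m (λ t → f (m ∸ suc t)) ≡ ∑ m f
∑-reverse zero    f = refl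
∑-reverse (suc m) f = begin
    ∑ m (λ t → f (m ∸ t)) + f (m ∸ m)
  ≡⟨ cong₂ _+_ (∑-ext m (λ t t<m → cong f (+-∸-assoc 1 t<m))) (cong f (n∸n≡0 m)) ⟩
    ∑ m (λ t → f (suc (m ∸ suc t))) + f 0
  ≡⟨ cong (_+ f 0) (∑-reverse m (λ t → f (suc t))) ⟩
    ∑ m (λ t → f (suc t)) + f 0
  ≡⟨ +-comm _ (f 0) ⟩
    f 0 + ∑ m (λ t → f (suc t))
  ≡⟨ sym (∑-suc m f) ⟩
    ∑ (suc m) f ∎
  where open ≡-Reasoning

∑-≥-term : ∀ m (f : ℕ → ℕ) t → t < m → f t ≤ ∑ m f
∑-≥-term (suc m) f t t<1+m with m≤n⇒m<n∨m≡n (≤-pred t<1+m)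
... | inj₁ t<m  = ≤-trans (∑-≥-term m f t t<m) (m≤m+n _ _)
... | inj₂ refl = m≤n+m _ _

∑-≥-two-terms : ∀ m (f : ℕ → ℕ) t₀ t₁ → t₀ < t₁ → t₁ < m → f t₀ + f t₁ ≤ ∑ m f
∑-≥-two-terms (suc m) f t₀ t₁ t₀<t₁ t₁<1+m with m≤n⇒m<n∨m≡n (≤-pred t₁<1+m)
... | inj₁ t₁<m = ≤-trans (∑-≥-two-terms m f t₀ t₁ t₀<t₁ t₁<m) (m≤m+n _ _)
... | inj₂ refl = +-monoˡ-≤ (f t₁) (∑-≥-term t₁ f t₀ t₀<t₁)

∑-zero : ∀ m (f : ℕ → ℕ) → (∀ t → t < m → f t ≡ 0) → ∑ m f ≡ 0
∑-zero m f f≗0 = trans (∑-ext m f≗0) (∑-const0 m)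
  where
    ∑-const0 : ∀ m → ∑ m (λ _ → 0) ≡ 0
    ∑-const0 zero    = refl
    ∑-const0 (suc m) = trans (+-identityʳ _) (∑-const0 m)

∑-single : ∀ m (f : ℕ → ℕ) t₀ → t₀ < m → (∀ t → t < m → t ≢ t₀ → f t ≡ 0) → ∑ m f ≡ f t₀
∑-single (suc m) f t₀ t₀<1+m others with m≤n⇒m<n∨m≡n (≤-pred t₀<1+m)
... | inj₁ t₀<m = trans (cong₂ _+_ (∑-single m f t₀ t₀<m (λ t t<m → others t (m<n⇒m<1+n t<m)))
                                   (others m ≤-refl (λ m≡t₀ → <⇒≢ t₀<m (sym m≡t₀))))
                        (+-identityʳ _)
... | inj₂ refl = cong (_+ f t₀) (∑-zero t₀ f (λ t t<t₀ → others t (m<n⇒m<1+n t<t₀) (<⇒≢ t<t₀)))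

∑-positive : ∀ m (f : ℕ → ℕ) → 1 ≤ ∑ m f → Σ ℕ λ t → t < m × 1 ≤ f t
∑-positive (suc m) f pos with f m in eq
... | suc _ = m , ≤-refl , subst (1 ≤_) (sym eq) (s≤s z≤n)
... | zero with ∑-positive m f (subst (1 ≤_) (+-identityʳ _) pos)
...   | t , t<m , ft = t , m<n⇒m<1+n t<m , ft

∑-two-positive : ∀ m (f : ℕ → ℕ) → (∀ t → f t ≤ 1) → 2 ≤ ∑ m f →
  Σ ℕ λ t₀ → Σ ℕ λ t₁ → t₀ < m × t₁ < m × t₀ ≢ t₁ × 1 ≤ f t₀ × 1 ≤ f t₁
∑-two-positive (suc m) f f≤1 two with f m in eq
... | zero with ∑-two-positive m f f≤1 (subst (2 ≤_) (+-identityʳ _) two)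
...   | t₀ , t₁ , t₀<m , t₁<m , t₀≢t₁ , ft₀ , ft₁ = t₀ , t₁ , m<n⇒m<1+n t₀<m , m<n⇒m<1+n t₁<m , t₀≢t₁ , ft₀ , ft₁
∑-two-positive (suc m) f f≤1 two | suc zero with ∑-positive m f (≤-pred (subst (2 ≤_) (+-comm _ 1) two))
... | t , t<m , ft = t , m , m<n⇒m<1+n t<m , ≤-refl , <⇒≢ t<m , ft , subst (1 ≤_) (sym eq) (s≤s z≤n)
∑-two-positive (suc m) f f≤1 two | suc (suc _) with subst (_≤ 1) eq (f≤1 m)
... | s≤s ()

𝟙 : ∀ {A : Set} → Dec A → ℕ
𝟙 (yes _) = 1
𝟙 (no _)  = 0

𝟙≤1 : ∀ {A : Set} (d : Dec A) → 𝟙 d ≤ 1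
𝟙≤1 (yes _) = s≤s z≤n
𝟙≤1 (no _)  = z≤n

𝟙-positive : ∀ {A : Set} (d : Dec A) → 1 ≤ 𝟙 d → A
𝟙-positive (yes a) _ = a

𝟙-yes : ∀ {A : Set} (d : Dec A) → A → 𝟙 d ≡ 1
𝟙-yes (yes _) _ = refl
𝟙-yes (no ¬a) a = ⊥-elim (¬a a)

𝟙-no : ∀ {A : Set} (d : Dec A) → ¬ A → 𝟙 d ≡ 0
𝟙-no (yes a) ¬a = ⊥-elim (¬a a)
𝟙-no (no _)  _  = refl

𝟙-⇔ : ∀ {A B : Set} (d₁ : Dec A) (d₂ : Dec B) → (A → B) → (B → A) → 𝟙 d₁ ≡ 𝟙 d₂
𝟙-⇔ (yes a) d₂ f g = sym (𝟙-yes d₂ (f a))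
𝟙-⇔ (no ¬a) d₂ f g = sym (𝟙-no d₂ (¬a ∘ g))

half-unique : ∀ a b → a + a ≡ b + b → a ≡ b
half-unique a b 2a≡2b = *-cancelˡ-≡ a b 2 (trans (double a) (trans 2a≡2b (sym (double b))))
  where
    double : ∀ x → 2 * x ≡ x + x
    double x = cong (x +_) (+-identityʳ x)

module Powers {M : ℕ} (ρ : Permutation′ M) (n-1 : ℕ) (ord : IsOrder ρ (suc n-1)) where

  n : ℕ
  n = suc n-1

  ρ^ : ℕ → Fin M → Fin M
  ρ^ = pow ρ

  ρ^-+ : ∀ a b x → ρ^ (a + b) x ≡ ρ^ a (ρ^ b x)
  ρ^-+ zero    b x = refl
  ρ^-+ (suc a) b x = cong (ρ ⟨$⟩ʳ_) (ρ^-+ a b x)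

  ρ^-comm : ∀ a b x → ρ^ a (ρ^ b x) ≡ ρ^ b (ρ^ a x)
  ρ^-comm a b x = trans (sym (ρ^-+ a b x)) (trans (cong (λ e → ρ^ e x) (+-comm a b)) (ρ^-+ b a x))

  ρ^n : ∀ x → ρ^ n x ≡ x
  ρ^n = proj₁ (proj₂ ord)

  ρ^-multiple : ∀ q x → ρ^ (q * n) x ≡ x
  ρ^-multiple zero    x = refl
  ρ^-multiple (suc q) x = trans (ρ^-+ n (q * n) x) (trans (cong (ρ^ n) (ρ^-multiple q x)) (ρ^n x))

  ρ^-mod : ∀ a x → ρ^ (a % n) x ≡ ρ^ a x
  ρ^-mod a x = sym (begin
      ρ^ a x                          ≡⟨ cong (λ e → ρ^ e x) (m≡m%n+[m/n]*n a n) ⟩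
      ρ^ (a % n + (a / n) * n) x      ≡⟨ ρ^-+ (a % n) _ x ⟩
      ρ^ (a % n) (ρ^ ((a / n) * n) x) ≡⟨ cong (ρ^ (a % n)) (ρ^-multiple (a / n) x) ⟩
      ρ^ (a % n) x                    ∎)
    where open ≡-Reasoning

  infix 4 _≈_
  _≈_ : ℕ → ℕ → Set
  a ≈ b = a % n ≡ b % n

  ρ^-≈ : ∀ {a b} x → a ≈ b → ρ^ a x ≡ ρ^ b x
  ρ^-≈ {a} {b} x a≈b = trans (sym (ρ^-mod a x)) (trans (cong (λ e → ρ^ e x) a≈b) (ρ^-mod b x))

  ≈-+ : ∀ {a a′ b b′} → a ≈ a′ → b ≈ b′ → a + b ≈ a′ + b′
  ≈-+ {a} {a′} {b} {b′} a≈a′ b≈b′ =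
    trans (%-distribˡ-+ a b n) (trans (cong₂ (λ p q → (p + q) % n) a≈a′ b≈b′) (sym (%-distribˡ-+ a′ b′ n)))

  ≈-mod : ∀ a → a % n ≈ a
  ≈-mod a = m%n%n≡m%n a n

  ≈-+n : ∀ a → a + n ≈ a
  ≈-+n a = [m+n]%n≡m%n a n

  ≈-+0 : ∀ {a} b → a % n ≡ 0 → b + a ≈ b
  ≈-+0 {a} b a≈0 = trans (≈-+ {b} {b} {a} {0} refl a≈0) (cong (_% n) (+-identityʳ b))

  ≈⇒≡ : ∀ {a b} → a < n → b < n → a ≈ b → a ≡ b
  ≈⇒≡ a<n b<n a≈b = trans (sym (m<n⇒m%n≡m a<n)) (trans a≈b (m<n⇒m%n≡m b<n))

  _⊖_ : ℕ → ℕ → ℕ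
  a ⊖ s = (a + (n ∸ s)) % n

  neg : ℕ → ℕ
  neg s = (n ∸ s) % n

  ⊖<n : ∀ a s → a ⊖ s < n
  ⊖<n a s = m%n<n (a + (n ∸ s)) n

  neg<n : ∀ s → neg s < n
  neg<n s = m%n<n (n ∸ s) n

  ρ^-⊖ : ∀ a s y → s ≤ n → ρ^ (a ⊖ s) (ρ^ s y) ≡ ρ^ a y
  ρ^-⊖ a s y s≤n = trans (sym (ρ^-+ (a ⊖ s) s y)) (ρ^-≈ {a ⊖ s + s} {a} y (trans (≈-+ {a ⊖ s} {a + (n ∸ s)} {s} {s} (≈-mod (a + (n ∸ s))) refl) a-s+s≈a))
    where
      a-s+s≈a : a + (n ∸ s) + s ≈ a
      a-s+s≈a = trans (cong (_% n) (trans (+-assoc a _ _) (cong (a +_) (m∸n+n≡m s≤n)))) (≈-+n a)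

  ⊖-of-sum : ∀ {i j t} → i < n → j ≡ (i + t) % n → j ⊖ i ≡ t % n
  ⊖-of-sum {i} {j} {t} i<n j≡i+t =
    trans (≈-+ {j} {i + t} {n ∸ i} {n ∸ i} (trans (cong (_% n) j≡i+t) (≈-mod (i + t))) refl)
          (trans (cong (_% n) rearrange) (≈-+n t))
    where
      rearrange : i + t + (n ∸ i) ≡ t + n
      rearrange = trans (cong (_+ (n ∸ i)) (+-comm i t)) (trans (+-assoc t i (n ∸ i)) (cong (t +_) (m+[n∸m]≡n (<⇒≤ i<n))))

  ⊖-cancel : ∀ i j → i ≤ n → i + j ⊖ i ≈ j
  ⊖-cancel i j i≤n = begin
      (i + j ⊖ i) % n          ≡⟨ ≈-+ {i} {i} {j ⊖ i} {j + (n ∸ i)} refl (≈-mod (j + (n ∸ i))) ⟩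
      (i + (j + (n ∸ i))) % n  ≡⟨ cong (_% n) rearrange ⟩
      (j + n) % n              ≡⟨ ≈-+n j ⟩
      j % n                    ∎
    where
      open ≡-Reasoning
      rearrange : i + (j + (n ∸ i)) ≡ j + n
      rearrange = trans (sym (+-assoc i j _)) (trans (cong (_+ (n ∸ i)) (+-comm i j))
                        (trans (+-assoc j i _) (cong (j +_) (m+[n∸m]≡n i≤n))))

  sum-of-⊖ : ∀ {i j t} → i < n → j < n → j ⊖ i ≡ t % n → j ≡ (i + t) % n
  sum-of-⊖ {i} {j} {t} i<n j<n j⊖i≡t = sym (begin
      (i + t) % n              ≡⟨ ≈-+ {i} {i} {t} {j ⊖ i} refl (sym (trans (≈-mod (j + (n ∸ i))) j⊖i≡t)) ⟩
      (i + j ⊖ i) % n          ≡⟨ ⊖-cancel i j (<⇒≤ i<n) ⟩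
      j % n                    ≡⟨ m<n⇒m%n≡m j<n ⟩
      j                        ∎)
    where open ≡-Reasoning

  ⊖-of-sum-reversed : ∀ {i j t} → i < n → i ≡ (j + t) % n → (j ⊖ i + t) % n ≡ 0
  ⊖-of-sum-reversed {i} {j} {t} i<n i≡j+t = begin
      (j ⊖ i + t) % n              ≡⟨ ≈-+ {j ⊖ i} {j + (n ∸ i)} {t} {t} (≈-mod (j + (n ∸ i))) refl ⟩
      (j + (n ∸ i) + t) % n        ≡⟨ cong (_% n) rearrange ⟩
      ((j + t) + (n ∸ i)) % n      ≡⟨ ≈-+ {j + t} {i} {n ∸ i} {n ∸ i} (trans (sym (≈-mod (j + t))) (cong (_% n) (sym i≡j+t))) refl ⟩
      (i + (n ∸ i)) % n            ≡⟨ cong (_% n) (m+[n∸m]≡n (<⇒≤ i<n)) ⟩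
      n % n                        ≡⟨ n%n≡0 n ⟩
      0                            ∎
    where
      open ≡-Reasoning
      rearrange : j + (n ∸ i) + t ≡ (j + t) + (n ∸ i)
      rearrange = trans (+-assoc j _ t) (trans (cong (j +_) (+-comm (n ∸ i) t)) (sym (+-assoc j t _)))

  sum-of-⊖-reversed : ∀ {i j t} → i < n → j < n → (j ⊖ i + t) % n ≡ 0 → i ≡ (j + t) % n
  sum-of-⊖-reversed {i} {j} {t} i<n j<n j⊖i+t≈0 = begin
      i                              ≡⟨ sym (m<n⇒m%n≡m i<n) ⟩
      i % n                          ≡⟨ sym (≈-+0 i j⊖i+t≈0) ⟩
      (i + (j ⊖ i + t)) % n          ≡⟨ ≈-+ {i} {i} {j ⊖ i + t} {j + (n ∸ i) + t} refl
                                             (≈-+ {j ⊖ i} {j + (n ∸ i)} {t} {t} (≈-mod (j + (n ∸ i))) refl) ⟩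
      (i + (j + (n ∸ i) + t)) % n    ≡⟨ cong (_% n) rearrange ⟩
      (j + t + n) % n                ≡⟨ ≈-+n (j + t) ⟩
      (j + t) % n                    ∎
    where
      open ≡-Reasoning
      shuffle : ∀ i j m t → i + ((j + m) + t) ≡ j + t + (i + m)
      shuffle = solve-∀
      rearrange : i + (j + (n ∸ i) + t) ≡ j + t + n
      rearrange = trans (shuffle i j (n ∸ i) t) (cong (j + t +_) (m+[n∸m]≡n (<⇒≤ i<n)))

  neg-cancel : ∀ x → x ≤ n → (neg x + x) % n ≡ 0
  neg-cancel x x≤n = trans (≈-+ {neg x} {n ∸ x} {x} {x} (≈-mod (n ∸ x)) refl) (trans (cong (_% n) (m∸n+n≡m x≤n)) (n%n≡0 n))

  neg-injective : ∀ {x y} → x < n → y < n → neg x ≡ neg y → x ≡ y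
  neg-injective {x} {y} x<n y<n -x≡-y = sym (≈⇒≡ y<n x<n (begin
      y % n                    ≡⟨ sym (≈-+0 y (neg-cancel x (<⇒≤ x<n))) ⟩
      (y + (neg x + x)) % n    ≡⟨ cong (_% n) (shuffle y (neg x) x) ⟩
      (x + (neg x + y)) % n    ≡⟨ cong (λ e → (x + (e + y)) % n) -x≡-y ⟩
      (x + (neg y + y)) % n    ≡⟨ ≈-+0 x (neg-cancel y (<⇒≤ y<n)) ⟩
      x % n                    ∎))
    where
      open ≡-Reasoning
      shuffle : ∀ y a x → y + (a + x) ≡ x + (a + y)
      shuffle = solve-∀

  neg-zero : ∀ {x} → x < n → neg x ≡ 0 → x ≡ 0
  neg-zero {x} x<n -x≡0 = trans (sym (m<n⇒m%n≡m x<n)) (subst (λ e → (e + x) % n ≡ 0) -x≡0 (neg-cancel x (<⇒≤ x<n)))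

  ρ-injective : ∀ {x y} → ρ ⟨$⟩ʳ x ≡ ρ ⟨$⟩ʳ y → x ≡ y
  ρ-injective ρx≡ρy = trans (sym (inverseˡ ρ)) (trans (cong (ρ ⟨$⟩ˡ_) ρx≡ρy) (inverseˡ ρ))

  ρ^-injective : ∀ a {x y} → ρ^ a x ≡ ρ^ a y → x ≡ y
  ρ^-injective zero    e = e
  ρ^-injective (suc a) e = ρ^-injective a (ρ-injective e)

  FullOrbit : Fin M → Set
  FullOrbit x = ∀ d → 0 < d → ρ^ d x ≡ x → n ≤ d

  FullOrbit-ρ^ : ∀ {x} s → FullOrbit x → FullOrbit (ρ^ s x)
  FullOrbit-ρ^ {x} s full d d>0 e = full d d>0 (ρ^-injective s (trans (ρ^-comm s d x) e))

  ρ^-ascending : ∀ {x} → FullOrbit x → ∀ {i j} → i < j → j < n → ρ^ i x ≢ ρ^ j x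
  ρ^-ascending {x} full {i} {j} i<j j<n e = <⇒≱ (≤-<-trans (m∸n≤m j i) j<n) (full (j ∸ i) (m<n⇒0<n∸m i<j) period)
    where
      period : ρ^ (j ∸ i) x ≡ x
      period = ρ^-injective i (begin
        ρ^ i (ρ^ (j ∸ i) x) ≡⟨ sym (ρ^-+ i (j ∸ i) x) ⟩
        ρ^ (i + (j ∸ i)) x  ≡⟨ cong (λ e → ρ^ e x) (m+[n∸m]≡n (<⇒≤ i<j)) ⟩
        ρ^ j x              ≡⟨ sym e ⟩
        ρ^ i x              ∎)
        where open ≡-Reasoning

  ρ^-distinct : ∀ {x} → FullOrbit x → ∀ {i j} → i < n → j < n → ρ^ i x ≡ ρ^ j x → i ≡ j
  ρ^-distinct full {i} {j} i<n j<n e with <-cmp i j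
  ... | tri< i<j _ _ = ⊥-elim (ρ^-ascending full i<j j<n e)
  ... | tri≈ _ i≡j _ = i≡j
  ... | tri> _ _ i>j = ⊥-elim (ρ^-ascending full i>j i<n (sym e))

  orbit-exponent : ∀ {x y} → SameOrbit ρ x y → Σ ℕ λ i → i < n × ρ^ i x ≡ y
  orbit-exponent {x} (i , e) = i % n , m%n<n i n , trans (ρ^-mod i x) e

  same-orbit : ∀ {x y} i j → ρ^ i x ≡ ρ^ j y → SameOrbit ρ x y
  same-orbit {x} {y} i j e = (n ∸ j % n) + i , (begin
      ρ^ ((n ∸ j % n) + i) x            ≡⟨ ρ^-+ (n ∸ j % n) i x ⟩
      ρ^ (n ∸ j % n) (ρ^ i x)           ≡⟨ cong (ρ^ (n ∸ j % n)) (trans e (sym (ρ^-mod j y))) ⟩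
      ρ^ (n ∸ j % n) (ρ^ (j % n) y)     ≡⟨ sym (ρ^-+ (n ∸ j % n) (j % n) y) ⟩
      ρ^ ((n ∸ j % n) + (j % n)) y      ≡⟨ cong (λ e → ρ^ e y) (m∸n+n≡m (<⇒≤ (m%n<n j n))) ⟩
      ρ^ n y                            ≡⟨ ρ^n y ⟩
      y                                 ∎)
    where open ≡-Reasoning

  orbit-sym : ∀ {x y} → SameOrbit ρ x y → SameOrbit ρ y x
  orbit-sym (i , e) = same-orbit 0 i (sym e)

  orbit-trans : ∀ {x y z} → SameOrbit ρ x y → SameOrbit ρ y z → SameOrbit ρ x z
  orbit-trans {x} (i , e) (j , f) = j + i , trans (ρ^-+ j i x) (trans (cong (ρ^ j) e) f)

  record ThreeOrbits (a b c : Fin M) : Set where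
    field
      a≁b : ¬ SameOrbit ρ a b
      a≁c : ¬ SameOrbit ρ a c
      b≁c : ¬ SameOrbit ρ b c
      cover : ∀ x → SameOrbit ρ a x ⊎ SameOrbit ρ b x ⊎ SameOrbit ρ c x
      full-a : FullOrbit a
      full-b : FullOrbit b
      full-c : FullOrbit c
  open ThreeOrbits public

  -- The hypothesis of the theorem: the common orbit length m satisfies ρ^m = id,
  -- so m ≥ n and every orbit has full length.
  three-orbits : ThreeEqualOrbits ρ → Σ (Fin M) λ a → Σ (Fin M) λ b → Σ (Fin M) λ c → ThreeOrbits a b c
  three-orbits (a , b , c , a≁b , a≁c , b≁c , cover , m , _ , (m>0 , ρ^m-a , min-a) , (_ , ρ^m-b , min-b) , (_ , ρ^m-c , min-c)) =
    a , b , c , record { a≁b = a≁b ; a≁c = a≁c ; b≁c = b≁c ; cover = cover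
                       ; full-a = full min-a ; full-b = full min-b ; full-c = full min-c }
    where
      fixed-on-orbit : ∀ {z} x → ρ^ m z ≡ z → SameOrbit ρ z x → ρ^ m x ≡ x
      fixed-on-orbit {z} x ρ^m-z (i , e) =
        trans (cong (ρ^ m) (sym e)) (trans (ρ^-comm m i z) (trans (cong (ρ^ i) ρ^m-z) e))
      ρ^m≡id : ∀ x → ρ^ m x ≡ x
      ρ^m≡id x with cover x
      ... | inj₁ a~x        = fixed-on-orbit x ρ^m-a a~x
      ... | inj₂ (inj₁ b~x) = fixed-on-orbit x ρ^m-b b~x
      ... | inj₂ (inj₂ c~x) = fixed-on-orbit x ρ^m-c c~x
      full : ∀ {z} → (∀ d → 0 < d → ρ^ d z ≡ z → m ≤ d) → FullOrbit z
      full min d d>0 e = ≤-trans (proj₂ (proj₂ ord) m m>0 ρ^m≡id) (min d d>0 e)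

  swap₁₂ : ∀ {a b c} → ThreeOrbits a b c → ThreeOrbits b a c
  swap₁₂ o = record { a≁b = a≁b o ∘ orbit-sym ; a≁c = b≁c o ; b≁c = a≁c o
    ; cover = λ x → reorder (cover o x) ; full-a = full-b o ; full-b = full-a o ; full-c = full-c o }
    where
      reorder : ∀ {A B C : Set} → A ⊎ B ⊎ C → B ⊎ A ⊎ C
      reorder (inj₁ a)        = inj₂ (inj₁ a)
      reorder (inj₂ (inj₁ b)) = inj₁ b
      reorder (inj₂ (inj₂ c)) = inj₂ (inj₂ c)

  swap₂₃ : ∀ {a b c} → ThreeOrbits a b c → ThreeOrbits a c b
  swap₂₃ o = record { a≁b = a≁c o ; a≁c = a≁b o ; b≁c = b≁c o ∘ orbit-sym
    ; cover = λ x → reorder (cover o x) ; full-a = full-a o ; full-b = full-c o ; full-c = full-b o }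
    where
      reorder : ∀ {A B C : Set} → A ⊎ B ⊎ C → A ⊎ C ⊎ B
      reorder (inj₁ a)        = inj₁ a
      reorder (inj₂ (inj₁ b)) = inj₂ (inj₂ b)
      reorder (inj₂ (inj₂ c)) = inj₂ (inj₁ c)

  rotate : ∀ {a b c} → ThreeOrbits a b c → ThreeOrbits c a b
  rotate = swap₁₂ ∘ swap₂₃

  move-first : ∀ {a b c} s → ThreeOrbits a b c → ThreeOrbits (ρ^ s a) b c
  move-first {a} s o = record { a≁b = a≁b o ∘ orbit-trans (s , refl)
    ; a≁c = a≁c o ∘ orbit-trans (s , refl) ; b≁c = b≁c o
    ; cover = λ x → recentre (cover o x) ; full-a = FullOrbit-ρ^ s (full-a o) ; full-b = full-b o ; full-c = full-c o }
    where
      recentre : ∀ {x B C} → SameOrbit ρ a x ⊎ B ⊎ C → SameOrbit ρ (ρ^ s a) x ⊎ B ⊎ C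
      recentre (inj₁ a~x) = inj₁ (orbit-trans (orbit-sym (s , refl)) a~x)
      recentre (inj₂ rest) = inj₂ rest

  move : ∀ {a b c} s₁ s₂ s₃ → ThreeOrbits a b c → ThreeOrbits (ρ^ s₁ a) (ρ^ s₂ b) (ρ^ s₃ c)
  move s₁ s₂ s₃ = rotate ∘ move-first s₂ ∘ rotate ∘ move-first s₃ ∘ rotate ∘ move-first s₁

module Links (Γ : Graph) (reg : ThreeRegular Γ) (ρ : Permutation′ (N Γ))
             (aut : IsAutomorphism Γ ρ) (n-1 : ℕ) (ord : IsOrder ρ (suc n-1)) where

  open Powers ρ n-1 ord public

  Vertex : Set
  Vertex = Fin (N Γ)

  ρ^-adj : ∀ a {x y} → Adj Γ x y → Adj Γ (ρ^ a x) (ρ^ a y)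
  ρ^-adj zero    x~y = x~y
  ρ^-adj (suc a) {x} {y} x~y = proj₁ (aut (ρ^ a x) (ρ^ a y)) (ρ^-adj a x~y)

  adj-reverse : ∀ {x y t} d → Adj Γ x (ρ^ t y) → (d + t) % n ≡ 0 → Adj Γ y (ρ^ d x)
  adj-reverse {x} {y} {t} d x~ρ^ty d+t≈0 = Graph.sym Γ (subst (Adj Γ (ρ^ d x)) back (ρ^-adj d x~ρ^ty))
    where
      back : ρ^ d (ρ^ t y) ≡ y
      back = trans (sym (ρ^-+ d t y)) (trans (sym (ρ^-mod (d + t) y)) (cong (λ e → ρ^ e y) d+t≈0))

  adj-relative : ∀ i j {x y} → i ≤ n → Adj Γ (ρ^ i x) (ρ^ j y) → Adj Γ x (ρ^ (j ⊖ i) y)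
  adj-relative i j {x} {y} i≤n a = subst₂ (Adj Γ) back shift (ρ^-adj (n ∸ i) a)
    where
      back : ρ^ (n ∸ i) (ρ^ i x) ≡ x
      back = trans (sym (ρ^-+ (n ∸ i) i x)) (trans (cong (λ e → ρ^ e x) (m∸n+n≡m i≤n)) (ρ^n x))
      shift : ρ^ (n ∸ i) (ρ^ j y) ≡ ρ^ (j ⊖ i) y
      shift = trans (sym (ρ^-+ (n ∸ i) j y))
                    (trans (cong (λ e → ρ^ e y) (+-comm (n ∸ i) j)) (sym (ρ^-mod (j + (n ∸ i)) y)))

  adj-absolute : ∀ i j {x y} → i ≤ n → Adj Γ x (ρ^ (j ⊖ i) y) → Adj Γ (ρ^ i x) (ρ^ j y)
  adj-absolute i j {x} {y} i≤n a = subst (Adj Γ (ρ^ i x)) forward (ρ^-adj i a)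
    where
      forward : ρ^ i (ρ^ (j ⊖ i) y) ≡ ρ^ j y
      forward = trans (sym (ρ^-+ i (j ⊖ i) y)) (ρ^-≈ {i + j ⊖ i} {j} y (⊖-cancel i j i≤n))

  links : Vertex → Vertex → ℕ
  links x y = ∑ n (λ t → 𝟙 (adj? Γ x (ρ^ t y)))

  -- x ~ ρ^t y ⇔ y ~ ρ^(n-t) x pairs the links counted on both sides
  links-sym : ∀ x y → links x y ≡ links y x
  links-sym x y = begin
      ∑ n f                                   ≡⟨ ∑-suc n-1 f ⟩
      f 0 + ∑ n-1 (λ t → f (suc t))           ≡⟨ cong₂ _+_ (𝟙-⇔ _ _ (Graph.sym Γ) (Graph.sym Γ))
                                                            (∑-ext n-1 (λ t t<n-1 → 𝟙-⇔ _ _ (forth t t<n-1) (back t t<n-1))) ⟩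
      g 0 + ∑ n-1 (λ t → g (suc (n-1 ∸ suc t))) ≡⟨ cong (g 0 +_) (∑-reverse n-1 (λ t → g (suc t))) ⟩
      g 0 + ∑ n-1 (λ t → g (suc t))           ≡⟨ sym (∑-suc n-1 g) ⟩
      ∑ n g                                   ∎
    where
      open ≡-Reasoning
      f g : ℕ → ℕ
      f t = 𝟙 (adj? Γ x (ρ^ t y))
      g t = 𝟙 (adj? Γ y (ρ^ t x))
      complement : ∀ t → t < n-1 → suc (n-1 ∸ suc t) + suc t ≡ n
      complement t t<n-1 = begin
        suc (n-1 ∸ suc t) + suc t ≡⟨ cong (_+ suc t) (sym (+-∸-assoc 1 t<n-1)) ⟩
        (n-1 ∸ t) + suc t         ≡⟨ +-suc (n-1 ∸ t) t ⟩
        suc ((n-1 ∸ t) + t)       ≡⟨ cong suc (m∸n+n≡m (<⇒≤ t<n-1)) ⟩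
        n                         ∎
      forth : ∀ t → t < n-1 → Adj Γ x (ρ^ (suc t) y) → Adj Γ y (ρ^ (suc (n-1 ∸ suc t)) x)
      forth t t<n-1 a = adj-reverse _ a (trans (cong (_% n) (complement t t<n-1)) (n%n≡0 n))
      back : ∀ t → t < n-1 → Adj Γ y (ρ^ (suc (n-1 ∸ suc t)) x) → Adj Γ x (ρ^ (suc t) y)
      back t t<n-1 a = adj-reverse _ a (trans (cong (_% n) (trans (+-comm (suc t) _) (complement t t<n-1))) (n%n≡0 n))

  hits : Vertex → Vertex → ℕ
  hits y z = ∑ n (λ t → 𝟙 (y F.≟ ρ^ t z))

  hits-zero : ∀ {y z} → (∀ t → ρ^ t z ≢ y) → hits y z ≡ 0
  hits-zero miss = ∑-zero n _ (λ t _ → 𝟙-no _ (miss t ∘ sym))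

  hits-one : ∀ {y z i} → FullOrbit z → i < n → ρ^ i z ≡ y → hits y z ≡ 1
  hits-one {y} {z} {i} full i<n ρ^iz≡y =
    trans (∑-single n _ i i<n (λ t t<n t≢i → 𝟙-no _ (λ y≡ρ^tz → t≢i (ρ^-distinct full t<n i<n (trans (sym y≡ρ^tz) (sym ρ^iz≡y))))))
          (𝟙-yes _ (sym ρ^iz≡y))

  hits-partition : ∀ {a b c} → ThreeOrbits a b c → ∀ y → hits y a + hits y b + hits y c ≡ 1
  hits-partition {a} {b} {c} o y with cover o y
  ... | inj₁ a~y with orbit-exponent a~y
  ...   | i , i<n , e = cong₂ _+_ (cong₂ _+_ (hits-one (full-a o) i<n e)
                          (hits-zero (λ t e′ → a≁b o (same-orbit i t (trans e (sym e′))))))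
                          (hits-zero (λ t e′ → a≁c o (same-orbit i t (trans e (sym e′)))))
  hits-partition {a} {b} {c} o y | inj₂ (inj₁ b~y) with orbit-exponent b~y
  ...   | i , i<n , e = cong₂ _+_ (cong₂ _+_ (hits-zero (λ t e′ → a≁b o (same-orbit t i (trans e′ (sym e)))))
                          (hits-one (full-b o) i<n e))
                          (hits-zero (λ t e′ → b≁c o (same-orbit i t (trans e (sym e′)))))
  hits-partition {a} {b} {c} o y | inj₂ (inj₂ c~y) with orbit-exponent c~y
  ...   | i , i<n , e = cong₂ _+_ (cong₂ _+_ (hits-zero (λ t e′ → a≁c o (same-orbit t i (trans e′ (sym e)))))
                          (hits-zero (λ t e′ → b≁c o (same-orbit t i (trans e′ (sym e))))))
                          (hits-one (full-c o) i<n e)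

  neighbour-indicator : ∀ x (y₁ y₂ y₃ : Vertex) → Adj Γ x y₁ → Adj Γ x y₂ → Adj Γ x y₃ →
    y₁ ≢ y₂ → y₁ ≢ y₃ → y₂ ≢ y₃ → (∀ y → Adj Γ x y → y ≡ y₁ ⊎ y ≡ y₂ ⊎ y ≡ y₃) →
    ∀ z → 𝟙 (adj? Γ x z) ≡ 𝟙 (y₁ F.≟ z) + 𝟙 (y₂ F.≟ z) + 𝟙 (y₃ F.≟ z)
  neighbour-indicator x y₁ y₂ y₃ x~y₁ x~y₂ x~y₃ y₁≢y₂ y₁≢y₃ y₂≢y₃ only z with adj? Γ x z
  ... | no x≁z = sym (cong₂ _+_ (cong₂ _+_ (𝟙-no (y₁ F.≟ z) (λ e → x≁z (subst (Adj Γ x) e x~y₁)))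
                                            (𝟙-no (y₂ F.≟ z) (λ e → x≁z (subst (Adj Γ x) e x~y₂))))
                                (𝟙-no (y₃ F.≟ z) (λ e → x≁z (subst (Adj Γ x) e x~y₃))))
  ... | yes x~z with only z x~z
  ...   | inj₁ refl        = sym (cong₂ _+_ (cong₂ _+_ (𝟙-yes (y₁ F.≟ z) refl) (𝟙-no (y₂ F.≟ z) (y₁≢y₂ ∘ sym)))
                                            (𝟙-no (y₃ F.≟ z) (y₁≢y₃ ∘ sym)))
  ...   | inj₂ (inj₁ refl) = sym (cong₂ _+_ (cong₂ _+_ (𝟙-no (y₁ F.≟ z) y₁≢y₂) (𝟙-yes (y₂ F.≟ z) refl))
                                            (𝟙-no (y₃ F.≟ z) (y₂≢y₃ ∘ sym)))
  ...   | inj₂ (inj₂ refl) = sym (cong₂ _+_ (cong₂ _+_ (𝟙-no (y₁ F.≟ z) y₁≢y₃) (𝟙-no (y₂ F.≟ z) y₂≢y₃))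
                                            (𝟙-yes (y₃ F.≟ z) refl))

  -- every vertex has three neighbours, distributed over the three orbits
  valency : ∀ {a b c} → ThreeOrbits a b c → ∀ x → links x a + links x b + links x c ≡ 3
  valency {a} {b} {c} o x with reg x
  ... | y₁ , y₂ , y₃ , x~y₁ , x~y₂ , x~y₃ , y₁≢y₂ , y₁≢y₃ , y₂≢y₃ , only = begin
      links x a + links x b + links x c
        ≡⟨ cong₂ _+_ (cong₂ _+_ (by-neighbours a) (by-neighbours b)) (by-neighbours c) ⟩
      (hits y₁ a + hits y₂ a + hits y₃ a) + (hits y₁ b + hits y₂ b + hits y₃ b) + (hits y₁ c + hits y₂ c + hits y₃ c)
        ≡⟨ transpose (hits y₁ a) (hits y₂ a) (hits y₃ a) (hits y₁ b) (hits y₂ b) (hits y₃ b) (hits y₁ c) (hits y₂ c) (hits y₃ c) ⟩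
      (hits y₁ a + hits y₁ b + hits y₁ c) + (hits y₂ a + hits y₂ b + hits y₂ c) + (hits y₃ a + hits y₃ b + hits y₃ c)
        ≡⟨ cong₂ _+_ (cong₂ _+_ (hits-partition o y₁) (hits-partition o y₂)) (hits-partition o y₃) ⟩
      3 ∎
    where
      open ≡-Reasoning
      by-neighbours : ∀ z → links x z ≡ hits y₁ z + hits y₂ z + hits y₃ z
      by-neighbours z = trans (∑-ext n (λ t _ → neighbour-indicator x y₁ y₂ y₃ x~y₁ x~y₂ x~y₃ y₁≢y₂ y₁≢y₃ y₂≢y₃ only (ρ^ t z)))
                              (trans (∑-+ n _ _) (cong (_+ hits y₃ z) (∑-+ n _ _)))
      transpose : ∀ a b c d e f g h i → (a + b + c) + (d + e + f) + (g + h + i) ≡ (a + d + g) + (b + e + h) + (c + f + i)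
      transpose = solve-∀

  links-positive : ∀ {x y t} → t < n → Adj Γ x (ρ^ t y) → 1 ≤ links x y
  links-positive {x} {y} {t} t<n a = subst (_≤ links x y) (𝟙-yes (adj? Γ x (ρ^ t y)) a) (∑-≥-term n _ t t<n)

  link-witness : ∀ {x y} → 1 ≤ links x y → Σ ℕ λ t → t < n × Adj Γ x (ρ^ t y)
  link-witness pos with ∑-positive n _ pos
  ... | t , t<n , ft = t , t<n , 𝟙-positive _ ft

  two-link-witnesses : ∀ {x y} → 2 ≤ links x y →
    Σ ℕ λ t₀ → Σ ℕ λ t₁ → t₀ < n × t₁ < n × t₀ ≢ t₁ × Adj Γ x (ρ^ t₀ y) × Adj Γ x (ρ^ t₁ y)
  two-link-witnesses {x} {y} two with ∑-two-positive n _ (λ t → 𝟙≤1 (adj? Γ x (ρ^ t y))) two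
  ... | t₀ , t₁ , t₀<n , t₁<n , t₀≢t₁ , ft₀ , ft₁ = t₀ , t₁ , t₀<n , t₁<n , t₀≢t₁ , 𝟙-positive _ ft₀ , 𝟙-positive _ ft₁

  links-≥2 : ∀ {x y} i j → i < j → j < n → Adj Γ x (ρ^ i y) → Adj Γ x (ρ^ j y) → 2 ≤ links x y
  links-≥2 {x} {y} i j i<j j<n aᵢ aⱼ =
    subst (_≤ links x y) (cong₂ _+_ (𝟙-yes (adj? Γ x (ρ^ i y)) aᵢ) (𝟙-yes (adj? Γ x (ρ^ j y)) aⱼ))
          (∑-≥-two-terms n _ i j i<j j<n)

  single-link : ∀ {x y t₀ t₁} → links x y ≡ 1 → t₀ < n → t₁ < n → Adj Γ x (ρ^ t₀ y) → Adj Γ x (ρ^ t₁ y) → t₀ ≡ t₁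
  single-link {t₀ = t₀} {t₁} one t₀<n t₁<n a₀ a₁ with <-cmp t₀ t₁
  ... | tri< t₀<t₁ _ _ = ⊥-elim (1+n≰n (subst (2 ≤_) one (links-≥2 t₀ t₁ t₀<t₁ t₁<n a₀ a₁)))
  ... | tri≈ _ e _     = e
  ... | tri> _ _ t₁<t₀ = ⊥-elim (1+n≰n (subst (2 ≤_) one (links-≥2 t₁ t₀ t₁<t₀ t₀<n a₁ a₀)))

  no-isolated-orbit : Connected Γ → ∀ {a b c} → ThreeOrbits a b c → links a b ≡ 0 → links a c ≡ 0 → ⊥
  no-isolated-orbit conn {a} {b} {c} o ab≡0 ac≡0 = a≁b o (reach (conn a b) (0 , refl))
    where
      no-link : ∀ {z} → links a z ≡ 0 → ∀ i j → i < n → Adj Γ (ρ^ i a) (ρ^ j z) → ⊥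
      no-link {z} az≡0 i j i<n a′ = 1+n≰n (subst (1 ≤_) az≡0
        (links-positive (⊖<n j i) (adj-relative i j (<⇒≤ i<n) a′)))
      step : ∀ {y z} → SameOrbit ρ a y → Adj Γ y z → SameOrbit ρ a z
      step {y} {z} a~y y~z with orbit-exponent a~y | cover o z
      ... | _ | inj₁ a~z = a~z
      ... | i , i<n , refl | inj₂ (inj₁ b~z) with orbit-exponent b~z
      ...   | j , _ , refl = ⊥-elim (no-link ab≡0 i j i<n y~z)
      step {y} {z} a~y y~z | i , i<n , refl | inj₂ (inj₂ c~z) with orbit-exponent c~z
      ...   | j , _ , refl = ⊥-elim (no-link ac≡0 i j i<n y~z)
      reach : ∀ {y z} → Star (Adj Γ) y z → SameOrbit ρ a y → SameOrbit ρ a z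
      reach ε            a~y = a~y
      reach (y~y′ ◅ path) a~y = reach path (step a~y y~y′)

  self-inverse-loop : ∀ {x t} → t < n → Adj Γ x (ρ^ t x) → t ≡ neg t → t + t ≡ n
  self-inverse-loop {x} {zero}  t<n x~x _ = ⊥-elim (Graph.irrefl Γ x~x)
  self-inverse-loop {x} {suc t} t<n _ t≡-t =
    trans (cong (_+ suc t) (trans t≡-t (m<n⇒m%n≡m (s≤s (m∸n≤m n-1 t))))) (m∸n+n≡m (<⇒≤ t<n))

  antipodal : ∀ {x} → links x x ≡ 1 → Σ ℕ λ k-1 → n ≡ 2 * suc k-1 × Adj Γ x (ρ^ (suc k-1) x)
  antipodal {x} one with link-witness {x} {x} (subst (1 ≤_) (sym one) ≤-refl)
  ... | zero    , _   , x~x = ⊥-elim (Graph.irrefl Γ x~x)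
  ... | suc k-1 , k<n , x~ρ^kx = k-1 , trans (sym 2k≡n) (cong (suc k-1 +_) (sym (+-identityʳ (suc k-1)))) , x~ρ^kx
    where
      x~ρ^-kx : Adj Γ x (ρ^ (n ∸ suc k-1) x)
      x~ρ^-kx = adj-reverse (n ∸ suc k-1) x~ρ^kx (trans (cong (_% n) (m∸n+n≡m (<⇒≤ k<n))) (n%n≡0 n))
      2k≡n : suc k-1 + suc k-1 ≡ n
      2k≡n = trans (cong (suc k-1 +_) (single-link one k<n (s≤s (m∸n≤m n-1 k-1)) x~ρ^kx x~ρ^-kx))
                   (m+[n∸m]≡n (<⇒≤ k<n))

  antipodal-unique : ∀ {x k₁ k₂} → n ≡ 2 * suc k₁ → n ≡ 2 * suc k₂ → Adj Γ x (ρ^ (suc k₂) x) → Adj Γ x (ρ^ (suc k₁) x)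
  antipodal-unique {x} {k₁} {k₂} n≡2k₁ n≡2k₂ =
    subst (λ e → Adj Γ x (ρ^ e x)) (*-cancelˡ-≡ (suc k₂) (suc k₁) 2 (trans (sym n≡2k₂) n≡2k₁))

  -- two neighbours inside the own orbit: at most one of them is antipodal
  non-antipodal-loop : ∀ {x} → links x x ≡ 2 → Σ ℕ λ s → s < n × Adj Γ x (ρ^ s x) × s ≢ neg s
  non-antipodal-loop {x} two with two-link-witnesses {x} {x} (subst (2 ≤_) (sym two) ≤-refl)
  ... | t₀ , t₁ , t₀<n , t₁<n , t₀≢t₁ , x~₀ , x~₁ with t₀ ≟ neg t₀ | t₁ ≟ neg t₁
  ...   | no t₀≢-t₀ | _          = t₀ , t₀<n , x~₀ , t₀≢-t₀
  ...   | yes _     | no t₁≢-t₁  = t₁ , t₁<n , x~₁ , t₁≢-t₁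
  ...   | yes t₀≡-t₀ | yes t₁≡-t₁ =
    ⊥-elim (t₀≢t₁ (half-unique t₀ t₁ (trans (self-inverse-loop t₀<n x~₀ t₀≡-t₀) (sym (self-inverse-loop t₁<n x~₁ t₁≡-t₁)))))

  loop-shift : ∀ {x} s d → Adj Γ x (ρ^ d x) → Adj Γ (ρ^ s x) (ρ^ d (ρ^ s x))
  loop-shift {x} s d a = subst (Adj Γ (ρ^ s x)) (ρ^-comm s d x) (ρ^-adj s a)

  link-shift : ∀ {y z t} s₁ s₂ → s₂ ≤ n → Adj Γ y (ρ^ t z) → Adj Γ (ρ^ s₁ y) (ρ^ ((s₁ + t) ⊖ s₂) (ρ^ s₂ z))
  link-shift {y} {z} {t} s₁ s₂ s₂≤n a =
    subst (Adj Γ (ρ^ s₁ y)) (trans (sym (ρ^-+ s₁ t z)) (sym (ρ^-⊖ (s₁ + t) s₂ z s₂≤n))) (ρ^-adj s₁ a)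

  link-shift-distinct : ∀ {z t t′} s₁ s₂ → s₂ ≤ n → FullOrbit z → t < n → t′ < n → t ≢ t′ → (s₁ + t) ⊖ s₂ ≢ (s₁ + t′) ⊖ s₂
  link-shift-distinct {z} {t} {t′} s₁ s₂ s₂≤n full t<n t′<n t≢t′ e = t≢t′ (ρ^-distinct full t<n t′<n (ρ^-injective s₁ (begin
      ρ^ s₁ (ρ^ t z)                    ≡⟨ sym (ρ^-+ s₁ t z) ⟩
      ρ^ (s₁ + t) z                     ≡⟨ sym (ρ^-⊖ (s₁ + t) s₂ z s₂≤n) ⟩
      ρ^ ((s₁ + t) ⊖ s₂) (ρ^ s₂ z)      ≡⟨ cong (λ d → ρ^ d (ρ^ s₂ z)) e ⟩
      ρ^ ((s₁ + t′) ⊖ s₂) (ρ^ s₂ z)     ≡⟨ ρ^-⊖ (s₁ + t′) s₂ z s₂≤n ⟩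
      ρ^ (s₁ + t′) z                    ≡⟨ ρ^-+ s₁ t′ z ⟩
      ρ^ s₁ (ρ^ t′ z)                   ∎)))
    where open ≡-Reasoning

-- The valency equations of three orbits a, b, c: every row of the symmetric
-- 3 × 3 matrix of links (off-diagonal ab, ac, bc; diagonal aa, bb, cc) sums to 3.
record ValencyEquations (ab ac bc aa bb cc : ℕ) : Set where
  constructor valency-equations
  field
    row-a : ab + ac + aa ≡ 3
    row-b : ab + bc + bb ≡ 3
    row-c : ac + bc + cc ≡ 3

unlinked-pair-solutions : ∀ {ab ac bc aa bb cc} → bc ≡ 0 → ab ≢ 0 → ac ≢ 0 → ValencyEquations ab ac bc aa bb cc →
  (ab ≡ 1 × ac ≡ 1 × aa ≡ 1 × bb ≡ 2 × cc ≡ 2) ⊎ (ab ≡ 1 × ac ≡ 2 × bb ≡ 2 × cc ≡ 1) ⊎ (ab ≡ 2 × ac ≡ 1 × bb ≡ 1 × cc ≡ 2)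
unlinked-pair-solutions {0}                   refl ab≢0 _    _ = ⊥-elim (ab≢0 refl)
unlinked-pair-solutions {suc _} {0}           refl _    ac≢0 _ = ⊥-elim (ac≢0 refl)
unlinked-pair-solutions {1} {1}               refl _ _ (valency-equations refl refl refl) = inj₁ (refl , refl , refl , refl , refl)
unlinked-pair-solutions {1} {2}               refl _ _ (valency-equations refl refl refl) = inj₂ (inj₁ (refl , refl , refl , refl))
unlinked-pair-solutions {1} {suc (suc (suc _))} refl _ _ (valency-equations () _ _)
unlinked-pair-solutions {2} {1}               refl _ _ (valency-equations refl refl refl) = inj₂ (inj₂ (refl , refl , refl , refl))
unlinked-pair-solutions {2} {suc (suc _)}     refl _ _ (valency-equations () _ _)
unlinked-pair-solutions {3} {suc _}           refl _ _ (valency-equations () _ _)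
unlinked-pair-solutions {suc (suc (suc (suc _)))} {suc _} refl _ _ (valency-equations _ () _)

double-pair-solutions : ∀ {ab ac bc aa bb cc} → ab ≢ 0 → ac ≢ 0 → 2 ≤ bc → ValencyEquations ab ac bc aa bb cc →
  ab ≡ 1 × ac ≡ 1 × bc ≡ 2 × aa ≡ 1
double-pair-solutions {_} {_} {0}           _ _ () _
double-pair-solutions {_} {_} {1}           _ _ (s≤s ()) _
double-pair-solutions {0}                   ab≢0 _    _ _ = ⊥-elim (ab≢0 refl)
double-pair-solutions {suc _} {0}           _    ac≢0 _ _ = ⊥-elim (ac≢0 refl)
double-pair-solutions {1} {1} {2}           _ _ _ (valency-equations refl refl refl) = refl , refl , refl , refl
double-pair-solutions {1} {1} {suc (suc (suc _))} _ _ _ (valency-equations _ () _)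
double-pair-solutions {1} {2} {suc (suc _)} _ _ _ (valency-equations _ _ ())
double-pair-solutions {1} {suc (suc (suc _))} _ _ _ (valency-equations () _ _)
double-pair-solutions {2} {suc _} {suc (suc _)} _ _ _ (valency-equations _ () _)
double-pair-solutions {3} {suc _}           _ _ _ (valency-equations () _ _)
double-pair-solutions {suc (suc (suc (suc _)))} {suc _} {suc (suc _)} _ _ _ (valency-equations _ () _)

single-links-solution : ∀ {ab ac bc aa bb cc} → ab ≢ 0 → ac ≢ 0 → bc ≢ 0 → ¬ 2 ≤ ab → ¬ 2 ≤ ac → ¬ 2 ≤ bc →
  ValencyEquations ab ac bc aa bb cc → ab ≡ 1 × ac ≡ 1 × bc ≡ 1 × aa ≡ 1 × bb ≡ 1 × cc ≡ 1
single-links-solution {0}           ab≢0 _ _ _ _ _ _ = ⊥-elim (ab≢0 refl)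
single-links-solution {_} {0}       _ ac≢0 _ _ _ _ _ = ⊥-elim (ac≢0 refl)
single-links-solution {_} {_} {0}   _ _ bc≢0 _ _ _ _ = ⊥-elim (bc≢0 refl)
single-links-solution {suc (suc _)} _ _ _ ab≱2 _ _ _ = ⊥-elim (ab≱2 (s≤s (s≤s z≤n)))
single-links-solution {_} {suc (suc _)} _ _ _ _ ac≱2 _ _ = ⊥-elim (ac≱2 (s≤s (s≤s z≤n)))
single-links-solution {_} {_} {suc (suc _)} _ _ _ _ _ bc≱2 _ = ⊥-elim (bc≱2 (s≤s (s≤s z≤n)))
single-links-solution {1} {1} {1}   _ _ _ _ _ _ (valency-equations refl refl refl) = refl , refl , refl , refl , refl , refl

-- Reading off the four possible link patterns.  Type_j k-1 records representatives
-- U, V, W of the three orbits at which the edges of T_j with index 0 are present,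
-- where k = suc k-1 and n = 2k.
module Classification (Γ : Graph) (reg : ThreeRegular Γ) (ρ : Permutation′ (N Γ))
                      (aut : IsAutomorphism Γ ρ) (n-1 : ℕ) (ord : IsOrder ρ (suc n-1)) where

  open Links Γ reg ρ aut n-1 ord public

  record Type₁ (k-1 : ℕ) : Set where
    field
      U V W   : Vertex
      orbits  : ThreeOrbits U V W
      u~u     : Adj Γ U (ρ^ (suc k-1) U)
      u~v     : Adj Γ U V
      u~w     : Adj Γ U W
      r s     : ℕ
      r<n     : r < n
      s<n     : s < n
      v~w₁    : Adj Γ V (ρ^ r W)
      v~w₂    : Adj Γ V (ρ^ s W)
      r≢s     : r ≢ s

  record Type₂ (k-1 : ℕ) : Set where
    field
      U V W   : Vertex
      orbits  : ThreeOrbits U V W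
      w~w     : Adj Γ W (ρ^ (suc k-1) W)
      u~v     : Adj Γ U V
      u~w₁    : Adj Γ U W
      r       : ℕ
      r<n     : r < n
      u~w₂    : Adj Γ U (ρ^ r W)
      r≢0     : r ≢ 0
      s       : ℕ
      s<n     : s < n
      v~v     : Adj Γ V (ρ^ s V)
      s≢-s    : s ≢ neg s

  record Type₃ (k-1 : ℕ) : Set where
    field
      U V W   : Vertex
      orbits  : ThreeOrbits U V W
      u~u     : Adj Γ U (ρ^ (suc k-1) U)
      v~v     : Adj Γ V (ρ^ (suc k-1) V)
      w~w     : Adj Γ W (ρ^ (suc k-1) W)
      u~v     : Adj Γ U V
      u~w     : Adj Γ U W
      r       : ℕ
      r<n     : r < n
      v~w     : Adj Γ V (ρ^ r W)

  record Type₄ (k-1 : ℕ) : Set where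
    field
      U V W   : Vertex
      orbits  : ThreeOrbits U V W
      u~u     : Adj Γ U (ρ^ (suc k-1) U)
      u~v     : Adj Γ U V
      u~w     : Adj Γ U W
      r       : ℕ
      r<n     : r < n
      w~w     : Adj Γ W (ρ^ r W)
      r≢-r    : r ≢ neg r
      s       : ℕ
      s<n     : s < n
      v~v     : Adj Γ V (ρ^ s V)
      s≢-s    : s ≢ neg s

  OneOfTheTypes : Set
  OneOfTheTypes = Σ ℕ λ k-1 → n ≡ 2 * suc k-1 × (Type₁ k-1 ⊎ Type₂ k-1 ⊎ Type₃ k-1 ⊎ Type₄ k-1)

  -- Each link pattern yields data of the corresponding type: find the links from
  -- the counts, then move V and W so that U ~ V and U ~ W.
  type₁ : ∀ {a b c} → ThreeOrbits a b c → links a a ≡ 1 → links a b ≡ 1 → links a c ≡ 1 → links b c ≡ 2 → OneOfTheTypes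
  type₁ {a} {b} {c} o aa≡1 ab≡1 ac≡1 bc≡2
    with antipodal aa≡1 | link-witness {a} {b} (≤-reflexive (sym ab≡1)) | link-witness {a} {c} (≤-reflexive (sym ac≡1))
       | two-link-witnesses {b} {c} (≤-reflexive (sym bc≡2))
  ... | k-1 , n≡2k , a~a | t₁ , _ , a~b | t₂ , t₂<n , a~c | t₃ , t₄ , t₃<n , t₄<n , t₃≢t₄ , b~c₃ , b~c₄ = k-1 , n≡2k , inj₁ record
    { U = a ; V = ρ^ t₁ b ; W = ρ^ t₂ c ; orbits = move 0 t₁ t₂ o
    ; u~u = a~a ; u~v = a~b ; u~w = a~c ; r = (t₁ + t₃) ⊖ t₂ ; s = (t₁ + t₄) ⊖ t₂
    ; r<n = ⊖<n (t₁ + t₃) t₂ ; s<n = ⊖<n (t₁ + t₄) t₂ ; v~w₁ = link-shift t₁ t₂ (<⇒≤ t₂<n) b~c₃ ; v~w₂ = link-shift t₁ t₂ (<⇒≤ t₂<n) b~c₄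
    ; r≢s = link-shift-distinct t₁ t₂ (<⇒≤ t₂<n) (full-c o) t₃<n t₄<n t₃≢t₄ }

  type₂ : ∀ {a b c} → ThreeOrbits a b c → links a b ≡ 1 → links a c ≡ 2 → links b b ≡ 2 → links c c ≡ 1 → OneOfTheTypes
  type₂ {a} {b} {c} o ab≡1 ac≡2 bb≡2 cc≡1
    with antipodal cc≡1 | link-witness {a} {b} (≤-reflexive (sym ab≡1))
       | two-link-witnesses {a} {c} (≤-reflexive (sym ac≡2)) | non-antipodal-loop bb≡2
  ... | k-1 , n≡2k , c~c | t₁ , _ , a~b | t₃ , t₄ , t₃<n , t₄<n , t₃≢t₄ , a~c₃ , a~c₄ | s , s<n , b~b , s≢-s = k-1 , n≡2k , inj₂ (inj₁ record
    { U = a ; V = ρ^ t₁ b ; W = ρ^ t₃ c ; orbits = move 0 t₁ t₃ o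
    ; w~w = loop-shift t₃ (suc k-1) c~c ; u~v = a~b ; u~w₁ = a~c₃ ; r = t₄ ⊖ t₃ ; r<n = ⊖<n t₄ t₃
    ; u~w₂ = subst (Adj Γ a) (sym (ρ^-⊖ t₄ t₃ c (<⇒≤ t₃<n))) a~c₄
    ; r≢0 = λ r≡0 → t₃≢t₄ (ρ^-distinct (full-c o) t₃<n t₄<n (sym (trans (sym (ρ^-⊖ t₄ t₃ c (<⇒≤ t₃<n))) (cong (λ e → ρ^ e (ρ^ t₃ c)) r≡0))))
    ; s = s ; s<n = s<n ; v~v = loop-shift t₁ s b~b ; s≢-s = s≢-s })

  type₃ : ∀ {a b c} → ThreeOrbits a b c → links a a ≡ 1 → links b b ≡ 1 → links c c ≡ 1 →
          links a b ≡ 1 → links a c ≡ 1 → links b c ≡ 1 → OneOfTheTypes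
  type₃ {a} {b} {c} o aa≡1 bb≡1 cc≡1 ab≡1 ac≡1 bc≡1
    with antipodal aa≡1 | antipodal bb≡1 | antipodal cc≡1
       | link-witness {a} {b} (≤-reflexive (sym ab≡1)) | link-witness {a} {c} (≤-reflexive (sym ac≡1))
       | link-witness {b} {c} (≤-reflexive (sym bc≡1))
  ... | k-1 , n≡2k , a~a | _ , n≡2k′ , b~b | _ , n≡2k″ , c~c | t₁ , _ , a~b | t₂ , t₂<n , a~c | t₃ , _ , b~c = k-1 , n≡2k , inj₂ (inj₂ (inj₁ record
    { U = a ; V = ρ^ t₁ b ; W = ρ^ t₂ c ; orbits = move 0 t₁ t₂ o
    ; u~u = a~a ; v~v = loop-shift t₁ (suc k-1) (antipodal-unique n≡2k n≡2k′ b~b) ; w~w = loop-shift t₂ (suc k-1) (antipodal-unique n≡2k n≡2k″ c~c)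
    ; u~v = a~b ; u~w = a~c ; r = (t₁ + t₃) ⊖ t₂ ; r<n = ⊖<n (t₁ + t₃) t₂ ; v~w = link-shift t₁ t₂ (<⇒≤ t₂<n) b~c }))

  type₄ : ∀ {a b c} → ThreeOrbits a b c → links a a ≡ 1 → links b b ≡ 2 → links c c ≡ 2 →
          links a b ≡ 1 → links a c ≡ 1 → OneOfTheTypes
  type₄ {a} {b} {c} o aa≡1 bb≡2 cc≡2 ab≡1 ac≡1
    with antipodal aa≡1 | link-witness {a} {b} (≤-reflexive (sym ab≡1)) | link-witness {a} {c} (≤-reflexive (sym ac≡1))
       | non-antipodal-loop bb≡2 | non-antipodal-loop cc≡2
  ... | k-1 , n≡2k , a~a | t₁ , _ , a~b | t₂ , _ , a~c | s , s<n , b~b , s≢-s | r , r<n , c~c , r≢-r = k-1 , n≡2k , inj₂ (inj₂ (inj₂ record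
    { U = a ; V = ρ^ t₁ b ; W = ρ^ t₂ c ; orbits = move 0 t₁ t₂ o
    ; u~u = a~a ; u~v = a~b ; u~w = a~c ; r = r ; r<n = r<n ; w~w = loop-shift t₂ r c~c ; r≢-r = r≢-r
    ; s = s ; s<n = s<n ; v~v = loop-shift t₁ s b~b ; s≢-s = s≢-s }))

  link-equations : ∀ {a b c} → ThreeOrbits a b c →
    ValencyEquations (links a b) (links a c) (links b c) (links a a) (links b b) (links c c)
  link-equations {a} {b} {c} o = valency-equations row-a row-b row-c
    where
      rotate-sum : ∀ x y z → x + y + z ≡ y + z + x
      rotate-sum = solve-∀
      swap-sum : ∀ x y z → x + y + z ≡ x + z + y
      swap-sum = solve-∀
      row-a : links a b + links a c + links a a ≡ 3
      row-a = trans (sym (rotate-sum (links a a) (links a b) (links a c))) (valency o a)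
      row-b : links a b + links b c + links b b ≡ 3
      row-b = trans (cong (λ e → e + links b c + links b b) (links-sym a b))
                    (trans (swap-sum (links b a) (links b c) (links b b)) (valency o b))
      row-c : links a c + links b c + links c c ≡ 3
      row-c = trans (cong₂ (λ p q → p + q + links c c) (links-sym a c) (links-sym b c)) (valency o c)

  linked-to-both : Connected Γ → ∀ {a b c} → ThreeOrbits a b c → links b c ≡ 0 → links a b ≢ 0 × links a c ≢ 0
  linked-to-both conn {a} {b} {c} o bc≡0 =
    (λ ab≡0 → no-isolated-orbit conn (swap₁₂ o) (trans (links-sym b a) ab≡0) bc≡0) ,
    (λ ac≡0 → no-isolated-orbit conn (rotate o) (trans (links-sym c a) ac≡0) (trans (links-sym c b) bc≡0))

  unlinked-pair : Connected Γ → ∀ {a b c} → ThreeOrbits a b c → links b c ≡ 0 → OneOfTheTypes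
  unlinked-pair conn o bc≡0 with linked-to-both conn o bc≡0
  ... | ab≢0 , ac≢0 with unlinked-pair-solutions bc≡0 ab≢0 ac≢0 (link-equations o)
  ...   | inj₁ (ab≡1 , ac≡1 , aa≡1 , bb≡2 , cc≡2)     = type₄ o aa≡1 bb≡2 cc≡2 ab≡1 ac≡1
  ...   | inj₂ (inj₁ (ab≡1 , ac≡2 , bb≡2 , cc≡1))     = type₂ o ab≡1 ac≡2 bb≡2 cc≡1
  ...   | inj₂ (inj₂ (ab≡2 , ac≡1 , bb≡1 , cc≡2))     = type₂ (swap₂₃ o) ac≡1 ab≡2 cc≡2 bb≡1

  double-pair : ∀ {a b c} → ThreeOrbits a b c → links a b ≢ 0 → links a c ≢ 0 → 2 ≤ links b c → OneOfTheTypes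
  double-pair o ab≢0 ac≢0 bc≥2 with double-pair-solutions ab≢0 ac≢0 bc≥2 (link-equations o)
  ... | ab≡1 , ac≡1 , bc≡2 , aa≡1 = type₁ o aa≡1 ab≡1 ac≡1 bc≡2

  single-links : ∀ {a b c} → ThreeOrbits a b c → links a b ≢ 0 → links a c ≢ 0 → links b c ≢ 0 →
                 ¬ 2 ≤ links a b → ¬ 2 ≤ links a c → ¬ 2 ≤ links b c → OneOfTheTypes
  single-links o ab≢0 ac≢0 bc≢0 ab≱2 ac≱2 bc≱2
    with single-links-solution ab≢0 ac≢0 bc≢0 ab≱2 ac≱2 bc≱2 (link-equations o)
  ... | ab≡1 , ac≡1 , bc≡1 , aa≡1 , bb≡1 , cc≡1 = type₃ o aa≡1 bb≡1 cc≡1 ab≡1 ac≡1 bc≡1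

  -- Relabel the orbits so that an unlinked pair, or else a doubly linked pair, is (b, c).
  classify : Connected Γ → ∀ {a b c} → ThreeOrbits a b c → OneOfTheTypes
  classify conn {a} {b} {c} o with links b c ≟ 0 | links a c ≟ 0 | links a b ≟ 0
  ... | yes bc≡0 | _        | _        = unlinked-pair conn o bc≡0
  ... | no _     | yes ac≡0 | _        = unlinked-pair conn (swap₁₂ o) ac≡0
  ... | no _     | no _     | yes ab≡0 = unlinked-pair conn (rotate o) ab≡0
  ... | no bc≢0  | no ac≢0  | no ab≢0 with 2 ≤? links b c | 2 ≤? links a c | 2 ≤? links a b
  ...   | yes bc≥2 | _        | _        = double-pair o ab≢0 ac≢0 bc≥2
  ...   | no _     | yes ac≥2 | _        = double-pair (swap₁₂ o) (ab≢0 ∘ trans (links-sym a b)) bc≢0 ac≥2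
  ...   | no _     | no _     | yes ab≥2 =
    double-pair (rotate o) (ac≢0 ∘ trans (links-sym a c)) (bc≢0 ∘ trans (links-sym b c)) ab≥2
  ...   | no bc≱2  | no ac≱2  | no ab≱2  = single-links o ab≢0 ac≢0 bc≢0 ab≱2 ac≱2 bc≱2

  one-of-the-types : Connected Γ → ThreeEqualOrbits ρ → OneOfTheTypes
  one-of-the-types conn teo with three-orbits teo
  ... | _ , _ , _ , o = classify conn o

data Label : Set where
  ℓu ℓv ℓw : Label

vertex : ∀ {k} → Label → Fin (2 * k) → TV k
vertex ℓu i = u i
vertex ℓv i = v i
vertex ℓw i = w i

label : ∀ {k} → TV k → Label
label (u _) = ℓu
label (v _) = ℓv
label (w _) = ℓw

index : ∀ {k} → TV k → Fin (2 * k)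
index (u i) = i
index (v i) = i
index (w i) = i

vertex-label-index : ∀ {k} (X : TV k) → vertex (label X) (index X) ≡ X
vertex-label-index (u _) = refl
vertex-label-index (v _) = refl
vertex-label-index (w _) = refl

label-vertex : ∀ {k} α (i : Fin (2 * k)) → label (vertex {k} α i) ≡ α
label-vertex ℓu i = refl
label-vertex ℓv i = refl
label-vertex ℓw i = refl

index-vertex : ∀ {k} α (i : Fin (2 * k)) → index (vertex {k} α i) ≡ i
index-vertex ℓu i = refl
index-vertex ℓv i = refl
index-vertex ℓw i = refl

-- A generator (α, β, t) stands for the edges α_i β_{i+t}, i ∈ ℤ_2k; every graph
-- T₁ … T₄ is the symmetric closure of the edges of a list of five or six generators.
Generator : Set
Generator = Label × Label × ℕ

data Generated (k : ℕ) (L : List Generator) : TV k → TV k → Set where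
  edge : ∀ {α β t} → (α , β , t) ∈ L → ∀ i → Generated k L (vertex α i) (vertex β (i ⊕ t))

distinct-members-include : ∀ {A : Set} {a b c y₁ y₂ y₃ : A} →
  (y₁ ≡ a ⊎ y₁ ≡ b ⊎ y₁ ≡ c) → (y₂ ≡ a ⊎ y₂ ≡ b ⊎ y₂ ≡ c) → (y₃ ≡ a ⊎ y₃ ≡ b ⊎ y₃ ≡ c) →
  y₁ ≢ y₂ → y₁ ≢ y₃ → y₂ ≢ y₃ → y₁ ≡ a ⊎ y₂ ≡ a ⊎ y₃ ≡ a
distinct-members-include (inj₁ e) _ _ _ _ _ = inj₁ e
distinct-members-include _ (inj₁ e) _ _ _ _ = inj₂ (inj₁ e)
distinct-members-include _ _ (inj₁ e) _ _ _ = inj₂ (inj₂ e)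
distinct-members-include (inj₂ (inj₁ e₁)) (inj₂ (inj₁ e₂)) _ y₁≢y₂ _ _ = ⊥-elim (y₁≢y₂ (trans e₁ (sym e₂)))
distinct-members-include (inj₂ (inj₂ e₁)) (inj₂ (inj₂ e₂)) _ y₁≢y₂ _ _ = ⊥-elim (y₁≢y₂ (trans e₁ (sym e₂)))
distinct-members-include (inj₂ (inj₁ e₁)) _ (inj₂ (inj₁ e₃)) _ y₁≢y₃ _ = ⊥-elim (y₁≢y₃ (trans e₁ (sym e₃)))
distinct-members-include (inj₂ (inj₂ e₁)) _ (inj₂ (inj₂ e₃)) _ y₁≢y₃ _ = ⊥-elim (y₁≢y₃ (trans e₁ (sym e₃)))
distinct-members-include _ (inj₂ (inj₁ e₂)) (inj₂ (inj₁ e₃)) _ _ y₂≢y₃ = ⊥-elim (y₂≢y₃ (trans e₂ (sym e₃)))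
distinct-members-include _ (inj₂ (inj₂ e₂)) (inj₂ (inj₂ e₃)) _ _ y₂≢y₃ = ⊥-elim (y₂≢y₃ (trans e₂ (sym e₃)))

second-first : ∀ {A : Set} {y a b c : A} → y ≡ a ⊎ y ≡ b ⊎ y ≡ c → y ≡ b ⊎ y ≡ a ⊎ y ≡ c
second-first (inj₁ e)        = inj₂ (inj₁ e)
second-first (inj₂ (inj₁ e)) = inj₁ e
second-first (inj₂ (inj₂ e)) = inj₂ (inj₂ e)

third-first : ∀ {A : Set} {y a b c : A} → y ≡ a ⊎ y ≡ b ⊎ y ≡ c → y ≡ c ⊎ y ≡ a ⊎ y ≡ b
third-first (inj₁ e)        = inj₂ (inj₁ e)
third-first (inj₂ (inj₁ e)) = inj₂ (inj₂ e)
third-first (inj₂ (inj₂ e)) = inj₁ e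

all-neighbours : (Γ : Graph) → ThreeRegular Γ → ∀ {x y₁ y₂ y₃} → Adj Γ x y₁ → Adj Γ x y₂ → Adj Γ x y₃ →
  y₁ ≢ y₂ → y₁ ≢ y₃ → y₂ ≢ y₃ → ∀ {y} → Adj Γ x y → y₁ ≡ y ⊎ y₂ ≡ y ⊎ y₃ ≡ y
all-neighbours Γ reg {x} x~y₁ x~y₂ x~y₃ d₁₂ d₁₃ d₂₃ x~y with reg x
... | _ , _ , _ , _ , _ , _ , _ , _ , _ , only with only _ x~y
...   | inj₁ refl        = distinct-members-include (only _ x~y₁) (only _ x~y₂) (only _ x~y₃) d₁₂ d₁₃ d₂₃
...   | inj₂ (inj₁ refl) = distinct-members-include (second-first (only _ x~y₁)) (second-first (only _ x~y₂))
                                                     (second-first (only _ x~y₃)) d₁₂ d₁₃ d₂₃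
...   | inj₂ (inj₂ refl) = distinct-members-include (third-first (only _ x~y₁)) (third-first (only _ x~y₂))
                                                     (third-first (only _ x~y₃)) d₁₂ d₁₃ d₂₃

SymClo-map : ∀ {A : Set} {E E′ : A → A → Set} → (∀ X Y → E X Y → E′ X Y) → ∀ X Y → SymClo E X Y → SymClo E′ X Y
SymClo-map f X Y (inj₁ e) = inj₁ (f X Y e)
SymClo-map f X Y (inj₂ e) = inj₂ (f Y X e)

Conclusion : Graph → ℕ → Set
Conclusion Γ n = Σ ℕ λ k → 0 < k × n ≡ 2 * k ×
  (Σ (Fin (2 * k)) λ r → Σ (Fin (2 * k)) λ s →
    IsoTo Γ k (T₁ k r s) ⊎ IsoTo Γ k (T₂ k r s) ⊎ IsoTo Γ k (T₃ k r) ⊎ IsoTo Γ k (T₄ k r s))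

pattern #0 = here refl
pattern #1 = there #0
pattern #2 = there #1
pattern #3 = there #2
pattern #4 = there #3
pattern #5 = there #4

module Recognition (Γ : Graph) (reg : ThreeRegular Γ) (ρ : Permutation′ (N Γ))
                   (aut : IsAutomorphism Γ ρ) (k-1 : ℕ) (ord : IsOrder ρ (2 * suc k-1)) where

  open Classification Γ reg ρ aut (k-1 + suc (k-1 + 0)) ord public

  k : ℕ
  k = suc k-1

  toℕ-⊕ : ∀ (i : Fin n) t → toℕ (i ⊕ t) ≡ (toℕ i + t) % n
  toℕ-⊕ i t = FP.toℕ-fromℕ< (m%n<n (toℕ i + t) n)

  ⊕-identityʳ : ∀ (i : Fin n) → i ⊕ 0 ≡ i
  ⊕-identityʳ i = FP.toℕ-injective (trans (toℕ-⊕ i 0) (trans (cong (_% n) (+-identityʳ (toℕ i))) (m<n⇒m%n≡m (FP.toℕ<n i))))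

  -- Fix representatives R α of the three orbits.  If every generator of L is realised
  -- at the representatives and, at each representative, three distinct generated
  -- links account for its three neighbours, then X_i ↦ ρ^i (R X) is an isomorphism
  -- from the graph generated by L onto Γ.
  module Generated-by (R : Label → Vertex) (orbits : ThreeOrbits (R ℓu) (R ℓv) (R ℓw)) (L : List Generator) where

    Link : Label → Label → ℕ → Set
    Link α β d = Adj Γ (R α) (ρ^ d (R β))

    Listed : Label → Label → ℕ → Set
    Listed α β d = (Σ ℕ λ t → (α , β , t) ∈ L × d ≡ t % n) ⊎ (Σ ℕ λ t → (β , α , t) ∈ L × (d + t) % n ≡ 0)

    full : ∀ α → FullOrbit (R α)
    full ℓu = full-a orbits
    full ℓv = full-b orbits
    full ℓw = full-c orbits

    same-label : ∀ {α β} d e → ρ^ d (R α) ≡ ρ^ e (R β) → α ≡ β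
    same-label {ℓu} {ℓu} d e eq = refl
    same-label {ℓu} {ℓv} d e eq = ⊥-elim (a≁b orbits (same-orbit d e eq))
    same-label {ℓu} {ℓw} d e eq = ⊥-elim (a≁c orbits (same-orbit d e eq))
    same-label {ℓv} {ℓu} d e eq = ⊥-elim (a≁b orbits (same-orbit e d (sym eq)))
    same-label {ℓv} {ℓv} d e eq = refl
    same-label {ℓv} {ℓw} d e eq = ⊥-elim (b≁c orbits (same-orbit d e eq))
    same-label {ℓw} {ℓu} d e eq = ⊥-elim (a≁c orbits (same-orbit e d (sym eq)))
    same-label {ℓw} {ℓv} d e eq = ⊥-elim (b≁c orbits (same-orbit e d (sym eq)))
    same-label {ℓw} {ℓw} d e eq = refl

    point-unique : ∀ {α β d e} → d < n → e < n → ρ^ d (R α) ≡ ρ^ e (R β) → α ≡ β × d ≡ e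
    point-unique {d = d} {e} d<n e<n eq with same-label d e eq
    ... | refl = refl , ρ^-distinct (full _) d<n e<n eq

    points-distinct : ∀ {α β d e} → d < n → e < n → α ≢ β ⊎ d ≢ e → ρ^ d (R α) ≢ ρ^ e (R β)
    points-distinct d<n e<n (inj₁ α≢β) eq = α≢β (proj₁ (point-unique d<n e<n eq))
    points-distinct d<n e<n (inj₂ d≢e) eq = d≢e (proj₂ (point-unique d<n e<n eq))

    record ListedNeighbours (α : Label) : Set where
      field
        β₁ β₂ β₃   : Label
        d₁ d₂ d₃   : ℕ
        d₁<n       : d₁ < n
        d₂<n       : d₂ < n
        d₃<n       : d₃ < n
        listed₁    : Listed α β₁ d₁
        listed₂    : Listed α β₂ d₂
        listed₃    : Listed α β₃ d₃
        distinct₁₂ : β₁ ≢ β₂ ⊎ d₁ ≢ d₂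
        distinct₁₃ : β₁ ≢ β₃ ⊎ d₁ ≢ d₃
        distinct₂₃ : β₂ ≢ β₃ ⊎ d₂ ≢ d₃

    position : TV k → Vertex
    position X = ρ^ (toℕ (index X)) (R (label X))

    position-vertex : ∀ α (i : Fin n) → position (vertex α i) ≡ ρ^ (toℕ i) (R α)
    position-vertex ℓu i = refl
    position-vertex ℓv i = refl
    position-vertex ℓw i = refl

    locate : ∀ x → Σ Label λ α → Σ ℕ λ i → i < n × ρ^ i (R α) ≡ x
    locate x with cover orbits x
    ... | inj₁ a~x        = ℓu , orbit-exponent a~x
    ... | inj₂ (inj₁ b~x) = ℓv , orbit-exponent b~x
    ... | inj₂ (inj₂ c~x) = ℓw , orbit-exponent c~x

    coordinates : Vertex → TV k
    coordinates x = vertex (proj₁ (locate x)) (fromℕ< (proj₁ (proj₂ (proj₂ (locate x)))))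

    position-coordinates : ∀ x → position (coordinates x) ≡ x
    position-coordinates x = at (locate x)
      where
        at : (loc : Σ Label λ α → Σ ℕ λ i → i < n × ρ^ i (R α) ≡ x) →
             position (vertex (proj₁ loc) (fromℕ< (proj₁ (proj₂ (proj₂ loc))))) ≡ x
        at (α , i , i<n , e) = trans (position-vertex α (fromℕ< i<n)) (trans (cong (λ j → ρ^ j (R α)) (FP.toℕ-fromℕ< i<n)) e)

    coordinates-position : ∀ X → coordinates (position X) ≡ X
    coordinates-position X = at (locate (position X))
      where
        at : (loc : Σ Label λ α → Σ ℕ λ i → i < n × ρ^ i (R α) ≡ position X) →
             vertex (proj₁ loc) (fromℕ< (proj₁ (proj₂ (proj₂ loc)))) ≡ X
        at (α , i , i<n , e) with point-unique i<n (FP.toℕ<n (index X)) e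
        ... | refl , refl = trans (cong (vertex (label X)) (FP.toℕ-injective (FP.toℕ-fromℕ< i<n))) (vertex-label-index X)

    offset : TV k → TV k → ℕ
    offset X Y = toℕ (index Y) ⊖ toℕ (index X)

    generated-forward : ∀ {X Y} → Generated k L X Y → Σ ℕ λ t → (label X , label Y , t) ∈ L × toℕ (index Y) ≡ (toℕ (index X) + t) % n
    generated-forward (edge {α} {β} {t} m i) =
      t , subst₂ (λ a b → (a , b , t) ∈ L) (sym (label-vertex {k} α i)) (sym (label-vertex {k} β (i ⊕ t))) m
        , subst₂ (λ (a b : Fin n) → toℕ b ≡ (toℕ a + t) % n) (sym (index-vertex {k} α i)) (sym (index-vertex {k} β (i ⊕ t))) (toℕ-⊕ i t)

    generated-backward : ∀ {X Y t} → (label X , label Y , t) ∈ L → toℕ (index Y) ≡ (toℕ (index X) + t) % n → Generated k L X Y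
    generated-backward {X} {Y} {t} m e =
      subst₂ (Generated k L) (vertex-label-index X) (trans (cong (vertex (label Y)) target) (vertex-label-index Y)) (edge m (index X))
      where
        target : index X ⊕ t ≡ index Y
        target = FP.toℕ-injective (trans (toℕ-⊕ (index X) t) (sym e))

    generated⇒listed : ∀ X Y → SymClo (Generated k L) X Y → Listed (label X) (label Y) (offset X Y)
    generated⇒listed X Y (inj₁ g) with generated-forward g
    ... | t , m , e = inj₁ (t , m , ⊖-of-sum {toℕ (index X)} {toℕ (index Y)} {t} (FP.toℕ<n (index X)) e)
    generated⇒listed X Y (inj₂ g) with generated-forward g
    ... | t , m , e = inj₂ (t , m , ⊖-of-sum-reversed {toℕ (index X)} {toℕ (index Y)} {t} (FP.toℕ<n (index X)) e)

    listed⇒generated : ∀ X Y → Listed (label X) (label Y) (offset X Y) → SymClo (Generated k L) X Y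
    listed⇒generated X Y (inj₁ (t , m , e)) = inj₁ (generated-backward m (sum-of-⊖ {toℕ (index X)} {toℕ (index Y)} {t} (FP.toℕ<n (index X)) (FP.toℕ<n (index Y)) e))
    listed⇒generated X Y (inj₂ (t , m , e)) = inj₂ (generated-backward m (sum-of-⊖-reversed {toℕ (index X)} {toℕ (index Y)} {t} (FP.toℕ<n (index X)) (FP.toℕ<n (index Y)) e))

    forward-listed : ∀ {α β t} → (α , β , t) ∈ L → t < n → Listed α β t
    forward-listed m t<n = inj₁ (_ , m , sym (m<n⇒m%n≡m t<n))

    backward-listed : ∀ {α β t} → (β , α , t) ∈ L → t < n → Listed α β (neg t)
    backward-listed {t = t} m t<n = inj₂ (t , m , neg-cancel t (<⇒≤ t<n))

    backward-listed₀ : ∀ {α β} → (β , α , 0) ∈ L → Listed α β 0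
    backward-listed₀ m = inj₂ (0 , m , refl)

    module _ (present : ∀ {α β t} → (α , β , t) ∈ L → Link α β t) (neighbours : ∀ α → ListedNeighbours α) where

      listed⇒link : ∀ {α β d} → Listed α β d → Link α β d
      listed⇒link {α} {β} (inj₁ (t , m , d≡t)) =
        subst (λ e → Adj Γ (R α) (ρ^ e (R β))) (sym d≡t) (subst (Adj Γ (R α)) (sym (ρ^-mod t (R β))) (present m))
      listed⇒link {d = d} (inj₂ (t , m , d+t≈0)) = adj-reverse d (present m) d+t≈0

      link⇒listed : ∀ {α β d} → d < n → Link α β d → Listed α β d
      link⇒listed {α} {β} {d} d<n x~y = pick (all-neighbours Γ reg (listed⇒link listed₁) (listed⇒link listed₂) (listed⇒link listed₃)
          (points-distinct d₁<n d₂<n distinct₁₂) (points-distinct d₁<n d₃<n distinct₁₃) (points-distinct d₂<n d₃<n distinct₂₃) x~y)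
        where
          open ListedNeighbours (neighbours α)
          pick : ρ^ d₁ (R β₁) ≡ ρ^ d (R β) ⊎ ρ^ d₂ (R β₂) ≡ ρ^ d (R β) ⊎ ρ^ d₃ (R β₃) ≡ ρ^ d (R β) → Listed α β d
          pick (inj₁ e) with point-unique d₁<n d<n e
          ... | refl , refl = listed₁
          pick (inj₂ (inj₁ e)) with point-unique d₂<n d<n e
          ... | refl , refl = listed₂
          pick (inj₂ (inj₂ e)) with point-unique d₃<n d<n e
          ... | refl , refl = listed₃

      recognised : IsoTo Γ k (SymClo (Generated k L))
      recognised = mk⤖ {to = coordinates} (injective , surjective) , λ x y → forth x y , back x y
        where
          injective : ∀ {x y} → coordinates x ≡ coordinates y → x ≡ y
          injective {x} {y} e = trans (sym (position-coordinates x)) (trans (cong position e) (position-coordinates y))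
          surjective : ∀ Y → ∃ λ x → ∀ {z} → z ≡ x → coordinates z ≡ Y
          surjective Y = position Y , λ e → trans (cong coordinates e) (coordinates-position Y)
          forth : ∀ x y → Adj Γ x y → SymClo (Generated k L) (coordinates x) (coordinates y)
          forth x y x~y = listed⇒generated X Y (link⇒listed (⊖<n (toℕ (index Y)) (toℕ (index X)))
              (adj-relative (toℕ (index X)) (toℕ (index Y)) (<⇒≤ (FP.toℕ<n (index X))) (subst₂ (Adj Γ) (sym (position-coordinates x)) (sym (position-coordinates y)) x~y)))
            where
              X Y : TV k
              X = coordinates x
              Y = coordinates y
          back : ∀ x y → SymClo (Generated k L) (coordinates x) (coordinates y) → Adj Γ x y
          back x y g = subst₂ (Adj Γ) (position-coordinates x) (position-coordinates y)
            (adj-absolute (toℕ (index X)) (toℕ (index Y)) (<⇒≤ (FP.toℕ<n (index X))) (listed⇒link (generated⇒listed X Y g)))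
            where
              X Y : TV k
              X = coordinates x
              Y = coordinates y

  iso-transfer : ∀ {T T′ : TV k → TV k → Set} →
    (∀ X Y → T X Y → T′ X Y) → (∀ X Y → T′ X Y → T X Y) → IsoTo Γ k T → IsoTo Γ k T′
  iso-transfer T⇒T′ T′⇒T (f , preserves) = f , λ x y →
    (λ x~y → T⇒T′ (Bijection.to f x) (Bijection.to f y) (proj₁ (preserves x y) x~y)) ,
    (λ fx~fy → proj₂ (preserves x y) (T′⇒T (Bijection.to f x) (Bijection.to f y) fx~fy))

  representatives : Vertex → Vertex → Vertex → Label → Vertex
  representatives U V W ℓu = U
  representatives U V W ℓv = V
  representatives U V W ℓw = W

  edge₀ : ∀ {L α β} → (α , β , 0) ∈ L → ∀ i → Generated k L (vertex α i) (vertex β i)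
  edge₀ {L} {α} {β} m i = subst (λ j → Generated k L (vertex α i) (vertex β j)) (⊕-identityʳ i) (edge m i)

  at-offset₀ : ∀ (E : TV k → TV k → Set) α β {i} → E (vertex α i) (vertex β i) → E (vertex α i) (vertex β (i ⊕ 0))
  at-offset₀ E α β {i} = subst (λ j → E (vertex α i) (vertex β j)) (sym (⊕-identityʳ i))

  k<n : k < n
  k<n = m<m+n k (s≤s z≤n)

  L₁ : Fin n → Fin n → List Generator
  L₁ r s = (ℓu , ℓu , k) ∷ (ℓu , ℓv , 0) ∷ (ℓu , ℓw , 0) ∷ (ℓv , ℓw , toℕ r) ∷ (ℓv , ℓw , toℕ s) ∷ []

  T₁⇒generated : ∀ r s X Y → T₁E k r s X Y → Generated k (L₁ r s) X Y
  T₁⇒generated r s _ _ (e1 i) = edge #0 i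
  T₁⇒generated r s _ _ (e2 i) = edge₀ #1 i
  T₁⇒generated r s _ _ (e3 i) = edge₀ #2 i
  T₁⇒generated r s _ _ (e4 i) = edge #3 i
  T₁⇒generated r s _ _ (e5 i) = edge #4 i

  generated⇒T₁ : ∀ r s X Y → Generated k (L₁ r s) X Y → T₁E k r s X Y
  generated⇒T₁ r s _ _ (edge #0 i) = e1 i
  generated⇒T₁ r s _ _ (edge #1 i) = at-offset₀ (T₁E k r s) ℓu ℓv (e2 i)
  generated⇒T₁ r s _ _ (edge #2 i) = at-offset₀ (T₁E k r s) ℓu ℓw (e3 i)
  generated⇒T₁ r s _ _ (edge #3 i) = e4 i
  generated⇒T₁ r s _ _ (edge #4 i) = e5 i
  generated⇒T₁ r s _ _ (edge (there (there (there (there (there ()))))) i)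

  isomorphism₁ : Type₁ k-1 → Σ (Fin n) λ r̂ → Σ (Fin n) λ ŝ → IsoTo Γ k (T₁ k r̂ ŝ)
  isomorphism₁ t = r̂ , ŝ , iso-transfer (SymClo-map (generated⇒T₁ r̂ ŝ)) (SymClo-map (T₁⇒generated r̂ ŝ)) (recognised present neighbours)
    where
      open Type₁ t
      r̂ ŝ : Fin n
      r̂ = fromℕ< r<n
      ŝ = fromℕ< s<n
      r̂≡r : toℕ r̂ ≡ r
      r̂≡r = FP.toℕ-fromℕ< r<n
      ŝ≡s : toℕ ŝ ≡ s
      ŝ≡s = FP.toℕ-fromℕ< s<n
      r̂≢ŝ : toℕ r̂ ≢ toℕ ŝ
      r̂≢ŝ e = r≢s (trans (sym r̂≡r) (trans e ŝ≡s))
      open Generated-by (representatives U V W) orbits (L₁ r̂ ŝ)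
      present : ∀ {α β t} → (α , β , t) ∈ L₁ r̂ ŝ → Link α β t
      present #0 = u~u
      present #1 = u~v
      present #2 = u~w
      present #3 = subst (λ e → Adj Γ V (ρ^ e W)) (sym r̂≡r) v~w₁
      present #4 = subst (λ e → Adj Γ V (ρ^ e W)) (sym ŝ≡s) v~w₂
      present (there (there (there (there (there ())))))
      neighbours : ∀ α → ListedNeighbours α
      neighbours ℓu = record
        { β₁ = ℓu ; β₂ = ℓv ; β₃ = ℓw ; d₁ = k ; d₂ = 0 ; d₃ = 0 ; d₁<n = k<n ; d₂<n = z<s ; d₃<n = z<s
        ; listed₁ = forward-listed #0 k<n ; listed₂ = forward-listed #1 z<s ; listed₃ = forward-listed #2 z<s
        ; distinct₁₂ = inj₁ (λ ()) ; distinct₁₃ = inj₁ (λ ()) ; distinct₂₃ = inj₁ (λ ()) }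
      neighbours ℓv = record
        { β₁ = ℓu ; β₂ = ℓw ; β₃ = ℓw ; d₁ = 0 ; d₂ = toℕ r̂ ; d₃ = toℕ ŝ ; d₁<n = z<s ; d₂<n = FP.toℕ<n r̂ ; d₃<n = FP.toℕ<n ŝ
        ; listed₁ = backward-listed₀ #1 ; listed₂ = forward-listed #3 (FP.toℕ<n r̂) ; listed₃ = forward-listed #4 (FP.toℕ<n ŝ)
        ; distinct₁₂ = inj₁ (λ ()) ; distinct₁₃ = inj₁ (λ ()) ; distinct₂₃ = inj₂ r̂≢ŝ }
      neighbours ℓw = record
        { β₁ = ℓu ; β₂ = ℓv ; β₃ = ℓv ; d₁ = 0 ; d₂ = neg (toℕ r̂) ; d₃ = neg (toℕ ŝ) ; d₁<n = z<s ; d₂<n = neg<n (toℕ r̂) ; d₃<n = neg<n (toℕ ŝ)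
        ; listed₁ = backward-listed₀ #2 ; listed₂ = backward-listed #3 (FP.toℕ<n r̂) ; listed₃ = backward-listed #4 (FP.toℕ<n ŝ)
        ; distinct₁₂ = inj₁ (λ ()) ; distinct₁₃ = inj₁ (λ ())
        ; distinct₂₃ = inj₂ (r̂≢ŝ ∘ neg-injective (FP.toℕ<n r̂) (FP.toℕ<n ŝ)) }

  L₂ : Fin n → Fin n → List Generator
  L₂ r s = (ℓw , ℓw , k) ∷ (ℓu , ℓv , 0) ∷ (ℓu , ℓw , 0) ∷ (ℓu , ℓw , toℕ r) ∷ (ℓv , ℓv , toℕ s) ∷ []

  T₂⇒generated : ∀ r s X Y → T₂E k r s X Y → Generated k (L₂ r s) X Y
  T₂⇒generated r s _ _ (e1 i) = edge #0 i
  T₂⇒generated r s _ _ (e2 i) = edge₀ #1 i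
  T₂⇒generated r s _ _ (e3 i) = edge₀ #2 i
  T₂⇒generated r s _ _ (e4 i) = edge #3 i
  T₂⇒generated r s _ _ (e5 i) = edge #4 i

  generated⇒T₂ : ∀ r s X Y → Generated k (L₂ r s) X Y → T₂E k r s X Y
  generated⇒T₂ r s _ _ (edge #0 i) = e1 i
  generated⇒T₂ r s _ _ (edge #1 i) = at-offset₀ (T₂E k r s) ℓu ℓv (e2 i)
  generated⇒T₂ r s _ _ (edge #2 i) = at-offset₀ (T₂E k r s) ℓu ℓw (e3 i)
  generated⇒T₂ r s _ _ (edge #3 i) = e4 i
  generated⇒T₂ r s _ _ (edge #4 i) = e5 i
  generated⇒T₂ r s _ _ (edge (there (there (there (there (there ()))))) i)

  isomorphism₂ : Type₂ k-1 → Σ (Fin n) λ r̂ → Σ (Fin n) λ ŝ → IsoTo Γ k (T₂ k r̂ ŝ)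
  isomorphism₂ t = r̂ , ŝ , iso-transfer (SymClo-map (generated⇒T₂ r̂ ŝ)) (SymClo-map (T₂⇒generated r̂ ŝ)) (recognised present neighbours)
    where
      open Type₂ t
      r̂ ŝ : Fin n
      r̂ = fromℕ< r<n
      ŝ = fromℕ< s<n
      r̂≡r : toℕ r̂ ≡ r
      r̂≡r = FP.toℕ-fromℕ< r<n
      ŝ≡s : toℕ ŝ ≡ s
      ŝ≡s = FP.toℕ-fromℕ< s<n
      open Generated-by (representatives U V W) orbits (L₂ r̂ ŝ)
      present : ∀ {α β t} → (α , β , t) ∈ L₂ r̂ ŝ → Link α β t
      present #0 = w~w
      present #1 = u~v
      present #2 = u~w₁
      present #3 = subst (λ e → Adj Γ U (ρ^ e W)) (sym r̂≡r) u~w₂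
      present #4 = subst (λ e → Adj Γ V (ρ^ e V)) (sym ŝ≡s) v~v
      present (there (there (there (there (there ())))))
      neighbours : ∀ α → ListedNeighbours α
      neighbours ℓu = record
        { β₁ = ℓv ; β₂ = ℓw ; β₃ = ℓw ; d₁ = 0 ; d₂ = 0 ; d₃ = toℕ r̂ ; d₁<n = z<s ; d₂<n = z<s ; d₃<n = FP.toℕ<n r̂
        ; listed₁ = forward-listed #1 z<s ; listed₂ = forward-listed #2 z<s ; listed₃ = forward-listed #3 (FP.toℕ<n r̂)
        ; distinct₁₂ = inj₁ (λ ()) ; distinct₁₃ = inj₁ (λ ())
        ; distinct₂₃ = inj₂ (λ 0≡r̂ → r≢0 (trans (sym r̂≡r) (sym 0≡r̂))) }
      neighbours ℓv = record
        { β₁ = ℓu ; β₂ = ℓv ; β₃ = ℓv ; d₁ = 0 ; d₂ = toℕ ŝ ; d₃ = neg (toℕ ŝ) ; d₁<n = z<s ; d₂<n = FP.toℕ<n ŝ ; d₃<n = neg<n (toℕ ŝ)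
        ; listed₁ = backward-listed₀ #1 ; listed₂ = forward-listed #4 (FP.toℕ<n ŝ) ; listed₃ = backward-listed #4 (FP.toℕ<n ŝ)
        ; distinct₁₂ = inj₁ (λ ()) ; distinct₁₃ = inj₁ (λ ())
        ; distinct₂₃ = inj₂ (λ ŝ≡-ŝ → s≢-s (subst (λ e → e ≡ neg e) ŝ≡s ŝ≡-ŝ)) }
      neighbours ℓw = record
        { β₁ = ℓw ; β₂ = ℓu ; β₃ = ℓu ; d₁ = k ; d₂ = 0 ; d₃ = neg (toℕ r̂) ; d₁<n = k<n ; d₂<n = z<s ; d₃<n = neg<n (toℕ r̂)
        ; listed₁ = forward-listed #0 k<n ; listed₂ = backward-listed₀ #2 ; listed₃ = backward-listed #3 (FP.toℕ<n r̂)
        ; distinct₁₂ = inj₁ (λ ()) ; distinct₁₃ = inj₁ (λ ())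
        ; distinct₂₃ = inj₂ (λ 0≡-r̂ → r≢0 (trans (sym r̂≡r) (neg-zero (FP.toℕ<n r̂) (sym 0≡-r̂)))) }

  L₃ : Fin n → List Generator
  L₃ r = (ℓu , ℓu , k) ∷ (ℓv , ℓv , k) ∷ (ℓw , ℓw , k) ∷ (ℓu , ℓv , 0) ∷ (ℓu , ℓw , 0) ∷ (ℓv , ℓw , toℕ r) ∷ []

  T₃⇒generated : ∀ r X Y → T₃E k r X Y → Generated k (L₃ r) X Y
  T₃⇒generated r _ _ (e1 i) = edge #0 i
  T₃⇒generated r _ _ (e2 i) = edge #1 i
  T₃⇒generated r _ _ (e3 i) = edge #2 i
  T₃⇒generated r _ _ (e4 i) = edge₀ #3 i
  T₃⇒generated r _ _ (e5 i) = edge₀ #4 i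
  T₃⇒generated r _ _ (e6 i) = edge #5 i

  generated⇒T₃ : ∀ r X Y → Generated k (L₃ r) X Y → T₃E k r X Y
  generated⇒T₃ r _ _ (edge #0 i) = e1 i
  generated⇒T₃ r _ _ (edge #1 i) = e2 i
  generated⇒T₃ r _ _ (edge #2 i) = e3 i
  generated⇒T₃ r _ _ (edge #3 i) = at-offset₀ (T₃E k r) ℓu ℓv (e4 i)
  generated⇒T₃ r _ _ (edge #4 i) = at-offset₀ (T₃E k r) ℓu ℓw (e5 i)
  generated⇒T₃ r _ _ (edge #5 i) = e6 i
  generated⇒T₃ r _ _ (edge (there (there (there (there (there (there ())))))) i)

  isomorphism₃ : Type₃ k-1 → Σ (Fin n) λ r̂ → IsoTo Γ k (T₃ k r̂)
  isomorphism₃ t = r̂ , iso-transfer (SymClo-map (generated⇒T₃ r̂)) (SymClo-map (T₃⇒generated r̂)) (recognised present neighbours)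
    where
      open Type₃ t
      r̂ : Fin n
      r̂ = fromℕ< r<n
      r̂≡r : toℕ r̂ ≡ r
      r̂≡r = FP.toℕ-fromℕ< r<n
      open Generated-by (representatives U V W) orbits (L₃ r̂)
      present : ∀ {α β t} → (α , β , t) ∈ L₃ r̂ → Link α β t
      present #0 = u~u
      present #1 = v~v
      present #2 = w~w
      present #3 = u~v
      present #4 = u~w
      present #5 = subst (λ e → Adj Γ V (ρ^ e W)) (sym r̂≡r) v~w
      present (there (there (there (there (there (there ()))))))
      neighbours : ∀ α → ListedNeighbours α
      neighbours ℓu = record
        { β₁ = ℓu ; β₂ = ℓv ; β₃ = ℓw ; d₁ = k ; d₂ = 0 ; d₃ = 0 ; d₁<n = k<n ; d₂<n = z<s ; d₃<n = z<s
        ; listed₁ = forward-listed #0 k<n ; listed₂ = forward-listed #3 z<s ; listed₃ = forward-listed #4 z<s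
        ; distinct₁₂ = inj₁ (λ ()) ; distinct₁₃ = inj₁ (λ ()) ; distinct₂₃ = inj₁ (λ ()) }
      neighbours ℓv = record
        { β₁ = ℓv ; β₂ = ℓu ; β₃ = ℓw ; d₁ = k ; d₂ = 0 ; d₃ = toℕ r̂ ; d₁<n = k<n ; d₂<n = z<s ; d₃<n = FP.toℕ<n r̂
        ; listed₁ = forward-listed #1 k<n ; listed₂ = backward-listed₀ #3 ; listed₃ = forward-listed #5 (FP.toℕ<n r̂)
        ; distinct₁₂ = inj₁ (λ ()) ; distinct₁₃ = inj₁ (λ ()) ; distinct₂₃ = inj₁ (λ ()) }
      neighbours ℓw = record
        { β₁ = ℓw ; β₂ = ℓu ; β₃ = ℓv ; d₁ = k ; d₂ = 0 ; d₃ = neg (toℕ r̂) ; d₁<n = k<n ; d₂<n = z<s ; d₃<n = neg<n (toℕ r̂)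
        ; listed₁ = forward-listed #2 k<n ; listed₂ = backward-listed₀ #4 ; listed₃ = backward-listed #5 (FP.toℕ<n r̂)
        ; distinct₁₂ = inj₁ (λ ()) ; distinct₁₃ = inj₁ (λ ()) ; distinct₂₃ = inj₁ (λ ()) }

  L₄ : Fin n → Fin n → List Generator
  L₄ r s = (ℓu , ℓu , k) ∷ (ℓu , ℓv , 0) ∷ (ℓu , ℓw , 0) ∷ (ℓw , ℓw , toℕ r) ∷ (ℓv , ℓv , toℕ s) ∷ []

  T₄⇒generated : ∀ r s X Y → T₄E k r s X Y → Generated k (L₄ r s) X Y
  T₄⇒generated r s _ _ (e1 i) = edge #0 i
  T₄⇒generated r s _ _ (e2 i) = edge₀ #1 i
  T₄⇒generated r s _ _ (e3 i) = edge₀ #2 i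
  T₄⇒generated r s _ _ (e4 i) = edge #3 i
  T₄⇒generated r s _ _ (e5 i) = edge #4 i

  generated⇒T₄ : ∀ r s X Y → Generated k (L₄ r s) X Y → T₄E k r s X Y
  generated⇒T₄ r s _ _ (edge #0 i) = e1 i
  generated⇒T₄ r s _ _ (edge #1 i) = at-offset₀ (T₄E k r s) ℓu ℓv (e2 i)
  generated⇒T₄ r s _ _ (edge #2 i) = at-offset₀ (T₄E k r s) ℓu ℓw (e3 i)
  generated⇒T₄ r s _ _ (edge #3 i) = e4 i
  generated⇒T₄ r s _ _ (edge #4 i) = e5 i
  generated⇒T₄ r s _ _ (edge (there (there (there (there (there ()))))) i)

  isomorphism₄ : Type₄ k-1 → Σ (Fin n) λ r̂ → Σ (Fin n) λ ŝ → IsoTo Γ k (T₄ k r̂ ŝ)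
  isomorphism₄ t = r̂ , ŝ , iso-transfer (SymClo-map (generated⇒T₄ r̂ ŝ)) (SymClo-map (T₄⇒generated r̂ ŝ)) (recognised present neighbours)
    where
      open Type₄ t
      r̂ ŝ : Fin n
      r̂ = fromℕ< r<n
      ŝ = fromℕ< s<n
      r̂≡r : toℕ r̂ ≡ r
      r̂≡r = FP.toℕ-fromℕ< r<n
      ŝ≡s : toℕ ŝ ≡ s
      ŝ≡s = FP.toℕ-fromℕ< s<n
      open Generated-by (representatives U V W) orbits (L₄ r̂ ŝ)
      present : ∀ {α β t} → (α , β , t) ∈ L₄ r̂ ŝ → Link α β t
      present #0 = u~u
      present #1 = u~v
      present #2 = u~w
      present #3 = subst (λ e → Adj Γ W (ρ^ e W)) (sym r̂≡r) w~w
      present #4 = subst (λ e → Adj Γ V (ρ^ e V)) (sym ŝ≡s) v~v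
      present (there (there (there (there (there ())))))
      neighbours : ∀ α → ListedNeighbours α
      neighbours ℓu = record
        { β₁ = ℓu ; β₂ = ℓv ; β₃ = ℓw ; d₁ = k ; d₂ = 0 ; d₃ = 0 ; d₁<n = k<n ; d₂<n = z<s ; d₃<n = z<s
        ; listed₁ = forward-listed #0 k<n ; listed₂ = forward-listed #1 z<s ; listed₃ = forward-listed #2 z<s
        ; distinct₁₂ = inj₁ (λ ()) ; distinct₁₃ = inj₁ (λ ()) ; distinct₂₃ = inj₁ (λ ()) }
      neighbours ℓv = record
        { β₁ = ℓu ; β₂ = ℓv ; β₃ = ℓv ; d₁ = 0 ; d₂ = toℕ ŝ ; d₃ = neg (toℕ ŝ) ; d₁<n = z<s ; d₂<n = FP.toℕ<n ŝ ; d₃<n = neg<n (toℕ ŝ)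
        ; listed₁ = backward-listed₀ #1 ; listed₂ = forward-listed #4 (FP.toℕ<n ŝ) ; listed₃ = backward-listed #4 (FP.toℕ<n ŝ)
        ; distinct₁₂ = inj₁ (λ ()) ; distinct₁₃ = inj₁ (λ ())
        ; distinct₂₃ = inj₂ (λ ŝ≡-ŝ → s≢-s (subst (λ e → e ≡ neg e) ŝ≡s ŝ≡-ŝ)) }
      neighbours ℓw = record
        { β₁ = ℓu ; β₂ = ℓw ; β₃ = ℓw ; d₁ = 0 ; d₂ = toℕ r̂ ; d₃ = neg (toℕ r̂) ; d₁<n = z<s ; d₂<n = FP.toℕ<n r̂ ; d₃<n = neg<n (toℕ r̂)
        ; listed₁ = backward-listed₀ #2 ; listed₂ = forward-listed #3 (FP.toℕ<n r̂) ; listed₃ = backward-listed #3 (FP.toℕ<n r̂)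
        ; distinct₁₂ = inj₁ (λ ()) ; distinct₁₃ = inj₁ (λ ())
        ; distinct₂₃ = inj₂ (λ r̂≡-r̂ → r≢-r (subst (λ e → e ≡ neg e) r̂≡r r̂≡-r̂)) }

  conclusion : Type₁ k-1 ⊎ Type₂ k-1 ⊎ Type₃ k-1 ⊎ Type₄ k-1 → Conclusion Γ n
  conclusion (inj₁ t) with isomorphism₁ t
  ... | r , s , iso = k , z<s , refl , r , s , inj₁ iso
  conclusion (inj₂ (inj₁ t)) with isomorphism₂ t
  ... | r , s , iso = k , z<s , refl , r , s , inj₂ (inj₁ iso)
  conclusion (inj₂ (inj₂ (inj₁ t))) with isomorphism₃ t
  ... | r , iso = k , z<s , refl , r , r , inj₂ (inj₂ (inj₁ iso))
  conclusion (inj₂ (inj₂ (inj₂ t))) with isomorphism₄ t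
  ... | r , s , iso = k , z<s , refl , r , s , inj₂ (inj₂ (inj₂ iso))

lemma2p3 : (Γ : Graph) → Cubic Γ → (ρ : Permutation′ (N Γ)) → IsAutomorphism Γ ρ →
    ThreeEqualOrbits ρ → (n : ℕ) → IsOrder ρ n →
      Σ ℕ λ k → 0 < k × n ≡ 2 * k ×
        (Σ (Fin (2 * k)) λ r → Σ (Fin (2 * k)) λ s →
          IsoTo Γ k (T₁ k r s) ⊎ IsoTo Γ k (T₂ k r s) ⊎ IsoTo Γ k (T₃ k r) ⊎ IsoTo Γ k (T₄ k r s))
lemma2p3 Γ (conn , reg) ρ aut three-orbits zero (() , _)
lemma2p3 Γ (conn , reg) ρ aut three-orbits (suc n-1) ord
  with Classification.one-of-the-types Γ reg ρ aut n-1 ord conn three-orbits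
... | k-1 , refl , type = Recognition.conclusion Γ reg ρ aut k-1 ord type
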